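{- Let $\mathbf f=(f_0,f_1,\dots)$ and $\boldsymbol\beta=(\beta_0,\beta_1,\dots)$ be non-negative integer vectors, $n=f_0$, $N=[n]$, and for $r\ge0$ let $\chi_{r-1}=\sum_{j\ge r}(-1)^{j-r}(f_j-\beta_j)$ (assume the families below are defined, i.e. $0\le\chi_r\le\chi_r+\beta_r\le\binom{n-1}{r+1}$). Let $E=\bigcup_{r\ge0}I(N\setminus\{1\},r,\chi_r+\beta_r)$, $C=\bigcup_{r\ge0}I(N\setminus\{1\},r,\chi_r)$, and $K_{\mathbf f,\boldsymbol\beta}=(1*C)\cup E$. Then $K_{\mathbf f,\boldsymbol\beta}$ is a simplicial complex with $f$-vector $\mathbf f$ and reduced Betti vector $\boldsymbol\beta$ if and only if $\chi_{ -1}=1$ and $\partial_r(n-1,\chi_r+\beta_r)\le\chi_{r-1}$ for all $r\ge1$.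
   Context: The $f$-vector counts $f_r$ faces of size $r+1$; reduced Betti numbers are over a fixed field. On $k$-subsets the lexicographic order is $A<B$ iff $\min(A\triangle B)\in A$. For a totally ordered finite set $N'$, $I(N',r,m)$ is the set of the first $m$ $(r+1)$-subsets of $N'$ in lex order; if $m\ge1$ with last element $\{a_0<\dots<a_r\}$, the augmented shadow $\overline{\partial I(N',r,m)}$ is the set of all $r$-subsets of $N'$ if $a_0$ is not the minimum of $N'$, and $\{A: |A|=r, A\le\{a_1,\dots,a_r\}\}$ if $a_0=\min N'$ (empty if $m=0$). $\partial_r(k,m)=|\overline{\partial I([k],r,m)}|$ (applied to $N\setminus\{1\}$, which is order-isomorphic to $[n-1]$). $1*C$ is the cone over $C$ with apex $1$, i.e. $C\cup\{\{1\}\cup A: A\in C\}\cup\{\{1\}\}$. -}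

module Defs where

open import Level using (Level) renaming (suc to lsuc; _⊔_ to _l⊔_)
open import Algebra.Bundles using (CommutativeRing)
open import Data.Nat using (ℕ; zero; suc; _+_; _∸_; _⊔_; _≡ᵇ_; _<ᵇ_; _≤ᵇ_)
open import Data.Integer as ℤ using (ℤ; +_; ∣_∣) renaming (_-_ to _-ℤ_)
open import Data.Bool using (Bool; true; false; _∧_; _∨_; not; if_then_else_; T)
open import Data.Vec using (Vec; []; _∷_)
open import Data.List using (List; []; _∷_; [_]; map; _++_; upTo; drop; length; foldr)
open import Data.Fin using (Fin) renaming (zero to fz; suc to fs)
open import Data.Product using (Σ; _×_; ∃)
open import Relation.Nullary using (¬_)

record Field (c ℓ : Level) : Set (lsuc (c l⊔ ℓ)) where
  field
    commutativeRing : CommutativeRing c ℓ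
  open CommutativeRing commutativeRing using (_≈_; _*_; 0#; 1#)
  field
    1≉0     : ¬ (1# ≈ 0#)
    inverse : ∀ x → ¬ (x ≈ 0#) → ∃ λ y → (x * y) ≈ 1#

-- Finite subsets of the totally ordered set {0 < 1 < … < n-1}
-- (position i stands for vertex i+1 of [n]); bit = membership.

Face : ℕ → Set
Face n = Vec Bool n

allSubsets : ∀ n → List (Face n)
allSubsets zero    = [ [] ]
allSubsets (suc n) = map (true ∷_) (allSubsets n) ++ map (false ∷_) (allSubsets n)

count : ∀ {a} {A : Set a} → (A → Bool) → List A → ℕ
count p []       = 0
count p (x ∷ xs) = if p x then suc (count p xs) else count p xs

any : ∀ {a} {A : Set a} → (A → Bool) → List A → Bool
any p []       = false
any p (x ∷ xs) = p x ∨ any p xs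

size : ∀ {n} → Face n → ℕ
size []          = 0
size (true ∷ a)  = suc (size a)
size (false ∷ a) = size a

isEmpty : ∀ {n} → Face n → Bool
isEmpty a = size a ≡ᵇ 0

eqF : ∀ {n} → Face n → Face n → Bool
eqF []          []          = true
eqF (true ∷ a)  (true ∷ b)  = eqF a b
eqF (false ∷ a) (false ∷ b) = eqF a b
eqF _           _           = false

subsetOf : ∀ {n} → Face n → Face n → Bool
subsetOf []          []          = true
subsetOf (true ∷ b)  (false ∷ a) = false
subsetOf (_ ∷ b)     (_ ∷ a)     = subsetOf b a

-- lexicographic order: A < B iff min (A △ B) ∈ A
lexLT : ∀ {n} → Face n → Face n → Bool
lexLT []          []          = false
lexLT (true ∷ a)  (false ∷ b) = true
lexLT (false ∷ a) (true ∷ b)  = false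
lexLT (true ∷ a)  (true ∷ b)  = lexLT a b
lexLT (false ∷ a) (false ∷ b) = lexLT a b

lexLE : ∀ {n} → Face n → Face n → Bool
lexLE a b = lexLT a b ∨ eqF a b

-- I(N', r, m) for N' = {0 < … < k-1}: the first m (r+1)-subsets in lex order.

predCount : (k r : ℕ) → Face k → ℕ
predCount k r A = count (λ B → (size B ≡ᵇ suc r) ∧ lexLT B A) (allSubsets k)

inI : (k r m : ℕ) → Face k → Bool
inI k r m A = (size A ≡ᵇ suc r) ∧ (predCount k r A <ᵇ m)

-- L is the last element of I(k, r, m)  (m ≥ 1)
isLast : (k r m : ℕ) → Face k → Bool
isLast k r m L = (size L ≡ᵇ suc r) ∧ (predCount k r L ≡ᵇ (m ∸ 1))

-- condition on an r-subset A given the last element L = {a_0 < … < a_r}: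
-- if a_0 is not min N' then every r-subset; else A ≤ {a_1,…,a_r}
shadowCond : ∀ {k} → Face k → Face k → Bool
shadowCond []          A = true
shadowCond (false ∷ L) A = true
shadowCond (true ∷ L)  A = lexLE A (false ∷ L)

-- membership in the augmented shadow of I(k, r, m)
inShadow : (k r m : ℕ) → Face k → Bool
inShadow k r m A =
  (1 ≤ᵇ m) ∧ (size A ≡ᵇ r) ∧ any (λ L → isLast k r m L ∧ shadowCond L A) (allSubsets k)

shadowSize : (k r m : ℕ) → ℕ
shadowSize k r m = count (inShadow k r m) (allSubsets k)

-- The vectors f, β (finite lists, padded with zeros) and χ.

get : List ℕ → ℕ → ℕ
get []       _       = 0
get (x ∷ xs) zero    = x
get (x ∷ xs) (suc j) = get xs j

diffs : List ℕ → List ℕ → List ℤ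
diffs f β = map (λ j → (+ get f j) -ℤ (+ get β j)) (upTo (length f ⊔ length β))

altSum : List ℤ → ℤ
altSum []       = + 0
altSum (x ∷ xs) = x -ℤ altSum xs

-- chiShift f β r = χ_{r-1} = Σ_{j ≥ r} (-1)^{j-r} (f_j - β_j)
chiShift : List ℕ → List ℕ → ℕ → ℤ
chiShift f β r = altSum (drop r (diffs f β))

chi : List ℕ → List ℕ → ℕ → ℤ
chi f β r = chiShift f β (suc r)

-- sizes of the families C and E in dimension r (as naturals; χ_r ≥ 0 is assumed)
mC : List ℕ → List ℕ → ℕ → ℕ
mC f β r = ∣ chi f β r ∣

mE : List ℕ → List ℕ → ℕ → ℕ
mE f β r = ∣ chi f β r ∣ + get β r

-- K_{f,β} on vertex set [n], n = suc n'; position 0 = vertex 1,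
-- positions 1..n' = N \ {1} (order-isomorphic to [n-1]).
-- A face is given by its (unique) dimension r = |A| - 1.

inC : List ℕ → List ℕ → (n' : ℕ) → Face n' → Bool
inC f β n' A = inI n' (size A ∸ 1) (mC f β (size A ∸ 1)) A

inE : List ℕ → List ℕ → (n' : ℕ) → Face n' → Bool
inE f β n' A = inI n' (size A ∸ 1) (mE f β (size A ∸ 1)) A

Kfβ : List ℕ → List ℕ → (n' : ℕ) → Face (suc n') → Bool
Kfβ f β n' (false ∷ A) = inC f β n' A ∨ inE f β n' A
Kfβ f β n' (true ∷ A)  = isEmpty A ∨ inC f β n' A

-- Simplicial complexes (sets of non-empty faces), f-vectors.

IsSimplicialComplex : ∀ {n} → (Face n → Bool) → Set
IsSimplicialComplex {n} K =
  ∀ (A B : Face n) → T (K A) → T (subsetOf B A) → T (not (isEmpty B)) → T (K B)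

fVec : ∀ {n} → (Face n → Bool) → ℕ → ℕ
fVec {n} K r = count (λ A → K A ∧ (size A ≡ᵇ suc r)) (allSubsets n)

module Homology {c ℓ : Level} (F : Field c ℓ) where
  open Field F using (commutativeRing)
  open CommutativeRing commutativeRing
    using (Carrier; _≈_; _*_; -_; 0#; 1#) renaming (_+_ to _⊕_)

  sumL : List Carrier → Carrier
  sumL = foldr _⊕_ 0#

  sumFin : ∀ b → (Fin b → Carrier) → Carrier
  sumFin zero    g = 0#
  sumFin (suc b) g = g fz ⊕ sumFin b (λ i → g (fs i))

  -- parity of the number of elements of B preceding the vertex A \ B
  parity : ∀ {n} → Face n → Face n → Bool
  parity (true ∷ a)  (true ∷ b)  = not (parity a b)
  parity (false ∷ a) (false ∷ b) = parity a b
  parity _           _           = false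

  sgn : ∀ {n} → Face n → Face n → Carrier
  sgn A B = if parity A B then - 1# else 1#

  Chain : ℕ → Set c
  Chain n = Face n → Carrier

  covers : ∀ {n} → Face n → Face n → Bool
  covers A B = subsetOf B A ∧ (size A ≡ᵇ suc (size B))

  boundary : ∀ {n} → Chain n → Chain n
  boundary {n} x B = sumL (map (λ A → if covers A B then sgn A B * x A else 0#) (allSubsets n))

  -- augmented complex K ∪ {∅} (the empty face carries degree -1)
  Kplus : ∀ {n} → (Face n → Bool) → Face n → Bool
  Kplus K A = K A ∨ isEmpty A

  -- chains supported on faces of K ∪ {∅} of size s (degree s - 1)
  IsChain : ∀ {n} → (Face n → Bool) → ℕ → Chain n → Set ℓ
  IsChain K s x = ∀ A → T (not (Kplus K A ∧ (size A ≡ᵇ s))) → x A ≈ 0#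

  IsCycle : ∀ {n} → (Face n → Bool) → ℕ → Chain n → Set ℓ
  IsCycle K s z = IsChain K s z × (∀ B → boundary z B ≈ 0#)

  lin : ∀ {n} b → (Fin b → Carrier) → (Fin b → Chain n) → Chain n
  lin b a z A = sumFin b (λ i → a i * z i A)

  -- the reduced homology H̃_r(K; F) has dimension b: there are b cycles
  -- whose classes form a basis of (cycles)/(boundaries) in degree r.
  Betti : ∀ {n} → (Face n → Bool) → ℕ → ℕ → Set (c l⊔ ℓ)
  Betti {n} K r b =
    Σ (Fin b → Chain n) λ z →
      (∀ i → IsCycle K (suc r) (z i)) ×
      (∀ (a : Fin b → Carrier) (w : Chain n) → IsChain K (suc (suc r)) w →
         (∀ A → lin b a z A ≈ boundary w A) → ∀ i → a i ≈ 0#) ×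
      (∀ (y : Chain n) → IsCycle K (suc r) y →
         Σ (Fin b → Carrier) λ a → Σ (Chain n) λ w →
           IsChain K (suc (suc r)) w × (∀ A → y A ≈ (lin b a z A ⊕ boundary w A)))

{-# OPTIONS --safe #-}
module Submission where

-- Faces of K of size r + 2 are the χ_r cones {1} ∪ c with c ∈ C_r and the χ_{r+1} + β_{r+1}
-- sets of E_{r+1}; with χ_{r-1} = (f_r - β_r) - χ_r this gives the f-vector f for free,
-- except f_0 = 1 + χ_0 + β_0, which says χ_{-1} = 1.
--
-- The augmented shadow of an initial lex segment is the smallest initial segment containing
-- all its facets, so ∂_{r+1}(n-1, χ_{r+1} + β_{r+1}) ≤ χ_r says exactly that every facet of a
-- face of E_{r+1} lies in C_r. Then K is closed under subsets, and each extra face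
-- G ∈ E_r ∖ C_r yields the cycle G - 1 * ∂G. These β_r cycles form a basis of H̃_r(K): a cycle
-- minus the right combination of them vanishes on E_r ∖ C_r, hence is the boundary of its cone.
-- Conversely, if a facet G of some H ∈ E_{r+1} misses C_r, then G is an extra face, and ∂H
-- restricted to the β_r extra faces would be independent of the restrictions of the β_r cycles
-- spanning H̃_r, which is impossible in F^{β_r}.

open import Defs
open import Data.Nat using (ℕ; suc; _≤_)
open import Data.Nat.Combinatorics using (_C_)
open import Data.Integer using (+_; ∣_∣) renaming (_≤_ to _≤ℤ_)
open import Data.List using (List)
open import Data.Product using (_×_; _,_)
open import Function.Bundles using (Equivalence; _⇔_; mk⇔)
open import Relation.Binary.PropositionalEquality using (_≡_)
open Equivalence using (to; from)

module SubsetCombinatorics where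

  open import Data.Nat using (zero; _+_; _∸_; _⊓_; _<_; _≡ᵇ_; _<ᵇ_; _≤ᵇ_; z≤n; s≤s; _<?_; _≤?_)
  open import Data.Nat.Properties
  open import Data.Nat.Combinatorics using (nCn≡1; nCk≡nC[n∸k]; k>n⇒nCk≡0; nCk+nC[k+1]≡[n+1]C[k+1])
  open import Data.Bool using (Bool; true; false; _∧_; not; T)
  open import Data.Bool.Properties using (T-∧; T-∨; ∧-zeroʳ; ∧-identityʳ)
  open import Data.Vec using ([]; _∷_)
  open import Data.List using ([]; _∷_; map; _++_)
  open import Data.Product using (Σ; Σ-syntax; proj₂)
  open import Data.Sum using (_⊎_; inj₁; inj₂)
  open import Data.Empty using (⊥-elim)
  open import Data.Unit using (tt)
  open import Relation.Binary.PropositionalEquality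
  open import Relation.Nullary using (¬_; yes; no)

  -- Counting and searching over all subsets

  count-++ : ∀ {a} {A : Set a} (p : A → Bool) xs ys → count p (xs ++ ys) ≡ count p xs + count p ys
  count-++ p [] ys = refl
  count-++ p (x ∷ xs) ys with p x
  ... | true  = cong suc (count-++ p xs ys)
  ... | false = count-++ p xs ys

  count-map : ∀ {a b} {A : Set a} {B : Set b} (p : B → Bool) (g : A → B) xs →
    count p (map g xs) ≡ count (λ x → p (g x)) xs
  count-map p g [] = refl
  count-map p g (x ∷ xs) with p (g x)
  ... | true  = cong suc (count-map p g xs)
  ... | false = count-map p g xs

  count-cong : ∀ {a} {A : Set a} {p q : A → Bool} → (∀ x → p x ≡ q x) → ∀ xs → count p xs ≡ count q xs
  count-cong e [] = refl
  count-cong {q = q} e (x ∷ xs) rewrite e x with q x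
  ... | true  = cong suc (count-cong e xs)
  ... | false = count-cong e xs

  count-cong-T : ∀ {a} {A : Set a} {p q : A → Bool} →
    (∀ x → T (p x) → T (q x)) → (∀ x → T (q x) → T (p x)) → ∀ xs → count p xs ≡ count q xs
  count-cong-T {p = p} {q} p⇒q q⇒p = count-cong p≡q
    where
    p≡q : ∀ x → p x ≡ q x
    p≡q x with p x | q x | p⇒q x | q⇒p x
    ... | true  | true  | _ | _ = refl
    ... | false | false | _ | _ = refl
    ... | true  | false | h | _ = ⊥-elim (h tt)
    ... | false | true  | _ | h = ⊥-elim (h tt)

  count-mono : ∀ {a} {A : Set a} {p q : A → Bool} → (∀ x → T (p x) → T (q x)) → ∀ xs → count p xs ≤ count q xs
  count-mono p⇒q [] = z≤n
  count-mono {p = p} {q} p⇒q (x ∷ xs) with p x | q x | p⇒q x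
  ... | true  | true  | _ = s≤s (count-mono p⇒q xs)
  ... | false | true  | _ = m≤n⇒m≤1+n (count-mono p⇒q xs)
  ... | false | false | _ = count-mono p⇒q xs
  ... | true  | false | h = ⊥-elim (h tt)

  count-false : ∀ {a} {A : Set a} {p : A → Bool} → (∀ x → p x ≡ false) → ∀ xs → count p xs ≡ 0
  count-false e [] = refl
  count-false e (x ∷ xs) rewrite e x = count-false e xs

  count-allSubsets-suc : ∀ k (p : Face (suc k) → Bool) →
    count p (allSubsets (suc k)) ≡ count (λ a → p (true ∷ a)) (allSubsets k) + count (λ a → p (false ∷ a)) (allSubsets k)
  count-allSubsets-suc k p = begin
    count p (map (true ∷_) (allSubsets k) ++ map (false ∷_) (allSubsets k))
      ≡⟨ count-++ p (map (true ∷_) (allSubsets k)) (map (false ∷_) (allSubsets k)) ⟩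
    count p (map (true ∷_) (allSubsets k)) + count p (map (false ∷_) (allSubsets k))
      ≡⟨ cong₂ _+_ (count-map p (true ∷_) (allSubsets k)) (count-map p (false ∷_) (allSubsets k)) ⟩
    count (λ a → p (true ∷ a)) (allSubsets k) + count (λ a → p (false ∷ a)) (allSubsets k) ∎
    where open ≡-Reasoning

  count-allSubsets-mono-< : ∀ k {p q : Face k → Bool} → (∀ x → T (p x) → T (q x)) →
    (x : Face k) → T (q x) → ¬ T (p x) → count p (allSubsets k) < count q (allSubsets k)
  count-allSubsets-mono-< zero {p} {q} p⇒q [] qx ¬px with p [] | q []
  ... | true  | _     = ⊥-elim (¬px tt)
  ... | false | true  = s≤s z≤n
  ... | false | false = ⊥-elim qx
  count-allSubsets-mono-< (suc k) {p} {q} p⇒q (true ∷ x) qx ¬px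
    rewrite count-allSubsets-suc k p | count-allSubsets-suc k q =
    +-mono-<-≤ (count-allSubsets-mono-< k (λ y → p⇒q (true ∷ y)) x qx ¬px)
               (count-mono (λ y → p⇒q (false ∷ y)) (allSubsets k))
  count-allSubsets-mono-< (suc k) {p} {q} p⇒q (false ∷ x) qx ¬px
    rewrite count-allSubsets-suc k p | count-allSubsets-suc k q =
    +-mono-≤-< (count-mono (λ y → p⇒q (true ∷ y)) (allSubsets k))
               (count-allSubsets-mono-< k (λ y → p⇒q (false ∷ y)) x qx ¬px)

  any-sound : ∀ {a} {A : Set a} {p : A → Bool} xs → T (any p xs) → Σ A λ x → T (p x)
  any-sound {p = p} (x ∷ xs) t with p x in eq
  ... | true  = x , subst T (sym eq) tt
  ... | false = any-sound xs t

  any-++ˡ : ∀ {a} {A : Set a} {p : A → Bool} xs ys → T (any p xs) → T (any p (xs ++ ys))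
  any-++ˡ {p = p} (x ∷ xs) ys t with p x
  ... | true  = tt
  ... | false = any-++ˡ xs ys t

  any-++ʳ : ∀ {a} {A : Set a} {p : A → Bool} xs ys → T (any p ys) → T (any p (xs ++ ys))
  any-++ʳ [] ys t = t
  any-++ʳ {p = p} (x ∷ xs) ys t with p x
  ... | true  = tt
  ... | false = any-++ʳ xs ys t

  any-map : ∀ {a b} {A : Set a} {B : Set b} (p : B → Bool) (g : A → B) xs →
    T (any (λ x → p (g x)) xs) → T (any p (map g xs))
  any-map p g (x ∷ xs) t with p (g x)
  ... | true  = tt
  ... | false = any-map p g xs t

  any-allSubsets : ∀ k {p : Face k → Bool} (x : Face k) → T (p x) → T (any p (allSubsets k))
  any-allSubsets zero {p} [] t with p []
  ... | true = tt
  any-allSubsets (suc k) {p} (true ∷ x) t =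
    any-++ˡ (map (true ∷_) (allSubsets k)) _
      (any-map p (true ∷_) (allSubsets k) (any-allSubsets k {λ a → p (true ∷ a)} x t))
  any-allSubsets (suc k) {p} (false ∷ x) t =
    any-++ʳ (map (true ∷_) (allSubsets k)) _
      (any-map p (false ∷_) (allSubsets k) (any-allSubsets k {λ a → p (false ∷ a)} x t))

  -- Faces and the lexicographic order

  size≤ : ∀ {k} (a : Face k) → size a ≤ k
  size≤ [] = z≤n
  size≤ (true ∷ a)  = s≤s (size≤ a)
  size≤ (false ∷ a) = m≤n⇒m≤1+n (size≤ a)

  eqF-refl : ∀ {k} (a : Face k) → T (eqF a a)
  eqF-refl [] = tt
  eqF-refl (true ∷ a)  = eqF-refl a
  eqF-refl (false ∷ a) = eqF-refl a

  eqF⇒≡ : ∀ {k} (a b : Face k) → T (eqF a b) → a ≡ b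
  eqF⇒≡ [] [] _ = refl
  eqF⇒≡ (true ∷ a)  (true ∷ b)  t = cong (true ∷_) (eqF⇒≡ a b t)
  eqF⇒≡ (false ∷ a) (false ∷ b) t = cong (false ∷_) (eqF⇒≡ a b t)

  ⊆-refl : ∀ {k} (a : Face k) → T (subsetOf a a)
  ⊆-refl [] = tt
  ⊆-refl (true ∷ a)  = ⊆-refl a
  ⊆-refl (false ∷ a) = ⊆-refl a

  ⊆⇒size≤ : ∀ {k} (b a : Face k) → T (subsetOf b a) → size b ≤ size a
  ⊆⇒size≤ [] [] _ = z≤n
  ⊆⇒size≤ (true ∷ b)  (true ∷ a) t = s≤s (⊆⇒size≤ b a t)
  ⊆⇒size≤ (false ∷ b) (true ∷ a) t = m≤n⇒m≤1+n (⊆⇒size≤ b a t)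
  ⊆⇒size≤ (false ∷ b) (false ∷ a) t = ⊆⇒size≤ b a t

  ⊆∧size≡⇒≡ : ∀ {k} (b a : Face k) → T (subsetOf b a) → size b ≡ size a → b ≡ a
  ⊆∧size≡⇒≡ [] [] _ _ = refl
  ⊆∧size≡⇒≡ (true ∷ b)  (true ∷ a)  t e = cong (true ∷_) (⊆∧size≡⇒≡ b a t (suc-injective e))
  ⊆∧size≡⇒≡ (false ∷ b) (true ∷ a)  t e = ⊥-elim (<-irrefl e (s≤s (⊆⇒size≤ b a t)))
  ⊆∧size≡⇒≡ (false ∷ b) (false ∷ a) t e = cong (false ∷_) (⊆∧size≡⇒≡ b a t e)

  covers : ∀ {k} → Face k → Face k → Bool
  covers a b = subsetOf b a ∧ (size a ≡ᵇ suc (size b))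

  covers⇒ : ∀ {k} (a b : Face k) → T (covers a b) → T (subsetOf b a) × size a ≡ suc (size b)
  covers⇒ a b t = let (b⊆a , e) = T-∧ {subsetOf b a} .to t in b⊆a , ≡ᵇ⇒≡ _ _ e

  covers⇐ : ∀ {k} (a b : Face k) → T (subsetOf b a) → size a ≡ suc (size b) → T (covers a b)
  covers⇐ a b b⊆a e = T-∧ .from (b⊆a , ≡⇒≡ᵇ _ _ e)

  facet-size : ∀ {k s} (a b : Face k) → T (covers a b) → size a ≡ suc s → size b ≡ s
  facet-size a b c e = suc-injective (trans (sym (proj₂ (covers⇒ a b c))) e)

  covers-true∷ : ∀ {k} (a : Face k) → T (covers (true ∷ a) (false ∷ a))
  covers-true∷ a = covers⇐ (true ∷ a) (false ∷ a) (⊆-refl a) refl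

  lex<-irrefl : ∀ {k} (a : Face k) → ¬ T (lexLT a a)
  lex<-irrefl (true ∷ a)  t = lex<-irrefl a t
  lex<-irrefl (false ∷ a) t = lex<-irrefl a t

  lex<-trans : ∀ {k} (a b c : Face k) → T (lexLT a b) → T (lexLT b c) → T (lexLT a c)
  lex<-trans [] [] [] () u
  lex<-trans (true ∷ a)  (true ∷ b)  (true ∷ c)  t u = lex<-trans a b c t u
  lex<-trans (true ∷ a)  (true ∷ b)  (false ∷ c) t u = tt
  lex<-trans (true ∷ a)  (false ∷ b) (false ∷ c) t u = tt
  lex<-trans (false ∷ a) (false ∷ b) (false ∷ c) t u = lex<-trans a b c t u

  lex-trichotomy : ∀ {k} (a b : Face k) → T (lexLT a b) ⊎ a ≡ b ⊎ T (lexLT b a)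
  lex-trichotomy [] [] = inj₂ (inj₁ refl)
  lex-trichotomy (true ∷ a)  (false ∷ b) = inj₁ tt
  lex-trichotomy (false ∷ a) (true ∷ b)  = inj₂ (inj₂ tt)
  lex-trichotomy (true ∷ a) (true ∷ b) with lex-trichotomy a b
  ... | inj₁ a<b        = inj₁ a<b
  ... | inj₂ (inj₁ a≡b) = inj₂ (inj₁ (cong (true ∷_) a≡b))
  ... | inj₂ (inj₂ b<a) = inj₂ (inj₂ b<a)
  lex-trichotomy (false ∷ a) (false ∷ b) with lex-trichotomy a b
  ... | inj₁ a<b        = inj₁ a<b
  ... | inj₂ (inj₁ a≡b) = inj₂ (inj₁ (cong (false ∷_) a≡b))
  ... | inj₂ (inj₂ b<a) = inj₂ (inj₂ b<a)

  lex≤⇒ : ∀ {k} (a b : Face k) → T (lexLE a b) → T (lexLT a b) ⊎ a ≡ b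
  lex≤⇒ a b t with T-∨ {lexLT a b} .to t
  ... | inj₁ a<b = inj₁ a<b
  ... | inj₂ a=b = inj₂ (eqF⇒≡ a b a=b)

  lex<⇒lex≤ : ∀ {k} (a b : Face k) → T (lexLT a b) → T (lexLE a b)
  lex<⇒lex≤ a b t = T-∨ .from (inj₁ t)

  lex≤-refl : ∀ {k} (a : Face k) → T (lexLE a a)
  lex≤-refl a = T-∨ {lexLT a a} .from (inj₂ (eqF-refl a))

  lex≤-trans : ∀ {k} (a b c : Face k) → T (lexLE a b) → T (lexLE b c) → T (lexLE a c)
  lex≤-trans a b c t u with lex≤⇒ a b t | lex≤⇒ b c u
  ... | inj₂ refl | _         = u
  ... | inj₁ _    | inj₂ refl = t
  ... | inj₁ a<b  | inj₁ b<c  = lex<⇒lex≤ a c (lex<-trans a b c a<b b<c)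

  nonempty⇒1≤size : ∀ {k} (b : Face k) → T (not (isEmpty b)) → 1 ≤ size b
  nonempty⇒1≤size b t with size b
  ... | suc _ = s≤s z≤n

  1≤size⇒nonempty : ∀ {k} (b : Face k) → 1 ≤ size b → T (not (isEmpty b))
  1≤size⇒nonempty b le with size b
  ... | suc _ = tt

  size≡suc⇒nonempty : ∀ {k r} (b : Face k) → size b ≡ suc r → T (not (isEmpty b))
  size≡suc⇒nonempty b e = 1≤size⇒nonempty b (subst (1 ≤_) (sym e) (s≤s z≤n))

  ⊆-empty : ∀ {k} (b a : Face k) → T (subsetOf b a) → T (isEmpty a) → T (isEmpty b)
  ⊆-empty b a b⊆a a-empty = ≡⇒≡ᵇ _ _ (n≤0⇒n≡0 (subst (size b ≤_) (≡ᵇ⇒≡ _ _ a-empty) (⊆⇒size≤ b a b⊆a)))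

  facet-through : ∀ {k} (a b : Face k) → T (subsetOf b a) → size b < size a →
    Σ[ a′ ∈ Face k ] T (covers a a′) × T (subsetOf b a′)
  facet-through (true ∷ a) (false ∷ b) b⊆a lt = false ∷ a , covers-true∷ a , b⊆a
  facet-through (true ∷ a) (true ∷ b) b⊆a (s≤s lt) =
    let (a′ , c , b⊆a′) = facet-through a b b⊆a lt in true ∷ a′ , c , b⊆a′
  facet-through (false ∷ a) (false ∷ b) b⊆a lt =
    let (a′ , c , b⊆a′) = facet-through a b b⊆a lt in false ∷ a′ , c , b⊆a′

  facet-closed⇒⊆-closed : ∀ {k} (Q : Face k → Set) →
    (∀ a b → Q a → T (covers a b) → T (not (isEmpty b)) → Q b) →
    ∀ a b → Q a → T (subsetOf b a) → T (not (isEmpty b)) → Q b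
  facet-closed⇒⊆-closed Q closed a b = go (size a) a (m≤m+n (size a) (size b))
    where
    go : ∀ d a → size a ≤ d + size b → Q a → T (subsetOf b a) → T (not (isEmpty b)) → Q b
    go d a le qa b⊆a ne with size b <? size a
    ... | no b≮a = subst Q (sym (⊆∧size≡⇒≡ b a b⊆a (≤-antisym (⊆⇒size≤ b a b⊆a) (≮⇒≥ b≮a)))) qa
    go zero    a le qa b⊆a ne | yes b<a = ⊥-elim (<⇒≱ b<a le)
    go (suc d) a le qa b⊆a ne | yes b<a =
      let (a′ , c , b⊆a′) = facet-through a b b⊆a b<a
          (_ , e) = covers⇒ a a′ c
          a′-nonempty = 1≤size⇒nonempty a′ (≤-trans (nonempty⇒1≤size b ne) (⊆⇒size≤ b a′ b⊆a′))
      in go d a′ (≤-pred (subst (_≤ suc (d + size b)) e le)) (closed a a′ qa c a′-nonempty) b⊆a′ ne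

  empty⊎nonempty : ∀ {k} (b : Face k) → T (isEmpty b) ⊎ T (not (isEmpty b))
  empty⊎nonempty b with isEmpty b
  ... | true  = inj₁ tt
  ... | false = inj₂ tt

  empty⇒¬nonempty : ∀ {k} (b : Face k) → T (isEmpty b) → ¬ T (not (isEmpty b))
  empty⇒¬nonempty b with isEmpty b
  ... | true = λ _ ()

  -- Lexicographic rank and the initial segments I(k, r, m)

  nC0≡1 : ∀ n → n C 0 ≡ 1
  nC0≡1 n = trans (nCk≡nC[n∸k] {0} {n} z≤n) (nCn≡1 n)

  0C[1+k]≡0 : ∀ k → 0 C suc k ≡ 0
  0C[1+k]≡0 k = k>n⇒nCk≡0 {n = 0} {k = suc k} (s≤s z≤n)

  count-size≡ : ∀ k s → count (λ B → size B ≡ᵇ s) (allSubsets k) ≡ k C s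
  count-size≡ zero zero    = sym (nCn≡1 0)
  count-size≡ zero (suc s) = sym (0C[1+k]≡0 s)
  count-size≡ (suc k) zero = begin
    count (λ B → size B ≡ᵇ 0) (allSubsets (suc k))
      ≡⟨ count-allSubsets-suc k _ ⟩
    count (λ _ → false) (allSubsets k) + count (λ B → size B ≡ᵇ 0) (allSubsets k)
      ≡⟨ cong (_+ count (λ B → size B ≡ᵇ 0) (allSubsets k)) (count-false (λ _ → refl) (allSubsets k)) ⟩
    count (λ B → size B ≡ᵇ 0) (allSubsets k)
      ≡⟨ count-size≡ k 0 ⟩
    k C 0
      ≡⟨ trans (nC0≡1 k) (sym (nC0≡1 (suc k))) ⟩
    suc k C 0 ∎
    where open ≡-Reasoning
  count-size≡ (suc k) (suc s) = begin
    count (λ B → size B ≡ᵇ suc s) (allSubsets (suc k))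
      ≡⟨ count-allSubsets-suc k _ ⟩
    count (λ B → size B ≡ᵇ s) (allSubsets k) + count (λ B → size B ≡ᵇ suc s) (allSubsets k)
      ≡⟨ cong₂ _+_ (count-size≡ k s) (count-size≡ k (suc s)) ⟩
    k C s + k C suc s
      ≡⟨ nCk+nC[k+1]≡[n+1]C[k+1] k s ⟩
    suc k C suc s ∎
    where open ≡-Reasoning

  rank : ∀ k → ℕ → Face k → ℕ
  rank k s A = count (λ B → (size B ≡ᵇ s) ∧ lexLT B A) (allSubsets k)

  rank-true∷ : ∀ k s (a : Face k) → rank (suc k) (suc s) (true ∷ a) ≡ rank k s a
  rank-true∷ k s a = begin
    rank (suc k) (suc s) (true ∷ a)
      ≡⟨ count-allSubsets-suc k _ ⟩
    rank k s a + count (λ B → (size B ≡ᵇ suc s) ∧ false) (allSubsets k)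
      ≡⟨ cong (_+_ (rank k s a)) (count-false (λ B → ∧-zeroʳ (size B ≡ᵇ suc s)) (allSubsets k)) ⟩
    rank k s a + 0
      ≡⟨ +-identityʳ _ ⟩
    rank k s a ∎
    where open ≡-Reasoning

  rank-false∷ : ∀ k s (a : Face k) → rank (suc k) (suc s) (false ∷ a) ≡ k C s + rank k (suc s) a
  rank-false∷ k s a = trans (count-allSubsets-suc k _)
    (cong (_+ rank k (suc s) a) (trans (count-cong (λ B → ∧-identityʳ (size B ≡ᵇ s)) (allSubsets k)) (count-size≡ k s)))

  rank0-false∷ : ∀ k (a : Face k) → rank (suc k) 0 (false ∷ a) ≡ rank k 0 a
  rank0-false∷ k a =
    trans (count-allSubsets-suc k _) (cong (_+ rank k 0 a) (count-false (λ _ → refl) (allSubsets k)))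

  rank-mono-< : ∀ k s (a b : Face k) → size a ≡ s → T (lexLT a b) → rank k s a < rank k s b
  rank-mono-< k s a b e a<b =
    count-allSubsets-mono-< k below-a⇒below-b a (T-∧ .from (≡⇒≡ᵇ _ _ e , a<b))
      (λ t → lex<-irrefl a (proj₂ (T-∧ {size a ≡ᵇ s} .to t)))
    where
    below-a⇒below-b : ∀ x → T ((size x ≡ᵇ s) ∧ lexLT x a) → T ((size x ≡ᵇ s) ∧ lexLT x b)
    below-a⇒below-b x t = let (ex , x<a) = T-∧ {size x ≡ᵇ s} .to t in T-∧ .from (ex , lex<-trans x a b x<a a<b)

  rank-mono-≤ : ∀ k s (a b : Face k) → size a ≡ s → T (lexLE a b) → rank k s a ≤ rank k s b
  rank-mono-≤ k s a b e a≤b with lex≤⇒ a b a≤b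
  ... | inj₁ a<b  = <⇒≤ (rank-mono-< k s a b e a<b)
  ... | inj₂ refl = ≤-refl

  rank-injective : ∀ k s (a b : Face k) → size a ≡ s → size b ≡ s → rank k s a ≡ rank k s b → a ≡ b
  rank-injective k s a b ea eb e with lex-trichotomy a b
  ... | inj₁ a<b        = ⊥-elim (<-irrefl e (rank-mono-< k s a b ea a<b))
  ... | inj₂ (inj₁ a≡b) = a≡b
  ... | inj₂ (inj₂ b<a) = ⊥-elim (<-irrefl (sym e) (rank-mono-< k s b a eb b<a))

  rank-cancel-≤ : ∀ k s (a b : Face k) → size a ≡ s → size b ≡ s → rank k s a ≤ rank k s b → T (lexLE a b)
  rank-cancel-≤ k s a b ea eb le with lex-trichotomy a b
  ... | inj₁ a<b         = lex<⇒lex≤ a b a<b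
  ... | inj₂ (inj₁ refl) = lex≤-refl a
  ... | inj₂ (inj₂ b<a)  = ⊥-elim (<⇒≱ (rank-mono-< k s b a eb b<a) le)

  unrank : ∀ k s i → i < k C s → Σ[ A ∈ Face k ] size A ≡ s × rank k s A ≡ i
  unrank zero zero zero _ = [] , refl , refl
  unrank zero zero (suc i) (s≤s ())
  unrank zero (suc s) i lt = ⊥-elim (n≮0 (subst (i <_) (0C[1+k]≡0 s) lt))
  unrank (suc k) zero i lt =
    let (A , eA , rA) = unrank k zero i (subst (i <_) (trans (nC0≡1 (suc k)) (sym (nC0≡1 k))) lt)
    in false ∷ A , eA , trans (rank0-false∷ k A) rA
  unrank (suc k) (suc s) i lt with i <? k C s
  ... | yes i<c = let (A , eA , rA) = unrank k s i i<c in true ∷ A , cong suc eA , trans (rank-true∷ k s A) rA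
  ... | no  i≮c =
    let c≤i = ≮⇒≥ i≮c
        lt′ : k C s + (i ∸ k C s) < k C s + k C suc s
        lt′ = subst₂ _<_ (sym (m+[n∸m]≡n c≤i)) (sym (nCk+nC[k+1]≡[n+1]C[k+1] k s)) lt
        (A , eA , rA) = unrank k (suc s) (i ∸ k C s) (+-cancelˡ-< (k C s) _ _ lt′)
    in false ∷ A , eA , trans (rank-false∷ k s A) (trans (cong (_+_ (k C s)) rA) (m+[n∸m]≡n c≤i))

  c+x<ᵇm≡x<ᵇm∸c : ∀ c x m → ((c + x) <ᵇ m) ≡ (x <ᵇ (m ∸ c))
  c+x<ᵇm≡x<ᵇm∸c zero    x m       = refl
  c+x<ᵇm≡x<ᵇm∸c (suc c) x zero    = refl
  c+x<ᵇm≡x<ᵇm∸c (suc c) x (suc m) = c+x<ᵇm≡x<ᵇm∸c c x m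

  m⊓c+[m∸c]⊓d≡m⊓[c+d] : ∀ m c d → m ⊓ c + (m ∸ c) ⊓ d ≡ m ⊓ (c + d)
  m⊓c+[m∸c]⊓d≡m⊓[c+d] m c d with m ≤? c
  ... | yes m≤c = begin
    m ⊓ c + (m ∸ c) ⊓ d ≡⟨ cong₂ _+_ (m≤n⇒m⊓n≡m m≤c) (cong (_⊓ d) (m≤n⇒m∸n≡0 m≤c)) ⟩
    m + 0               ≡⟨ +-identityʳ m ⟩
    m                   ≡⟨ m≤n⇒m⊓n≡m (≤-trans m≤c (m≤m+n c d)) ⟨
    m ⊓ (c + d)         ∎
    where open ≡-Reasoning
  ... | no m≰c = begin
    m ⊓ c + (m ∸ c) ⊓ d   ≡⟨ cong (_+ (m ∸ c) ⊓ d) (m≥n⇒m⊓n≡n c≤m) ⟩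
    c + (m ∸ c) ⊓ d       ≡⟨ +-distribˡ-⊓ c (m ∸ c) d ⟩
    (c + (m ∸ c)) ⊓ (c + d) ≡⟨ cong (_⊓ (c + d)) (m+[n∸m]≡n c≤m) ⟩
    m ⊓ (c + d)           ∎
    where
    open ≡-Reasoning
    c≤m : c ≤ m
    c≤m = <⇒≤ (≰⇒> m≰c)

  count-rank< : ∀ k s m → count (λ A → (size A ≡ᵇ s) ∧ (rank k s A <ᵇ m)) (allSubsets k) ≡ m ⊓ (k C s)
  count-rank< zero zero zero    = refl
  count-rank< zero zero (suc m) = cong suc (sym (⊓-zeroʳ m))
  count-rank< zero (suc s) m    = sym (trans (cong (m ⊓_) (0C[1+k]≡0 s)) (⊓-zeroʳ m))
  count-rank< (suc k) zero m = begin
    count (λ A → (size A ≡ᵇ 0) ∧ (rank (suc k) 0 A <ᵇ m)) (allSubsets (suc k))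
      ≡⟨ count-allSubsets-suc k _ ⟩
    count (λ _ → false) (allSubsets k) + count (λ A → (size A ≡ᵇ 0) ∧ (rank (suc k) 0 (false ∷ A) <ᵇ m)) (allSubsets k)
      ≡⟨ cong₂ _+_ (count-false (λ _ → refl) (allSubsets k))
                   (count-cong (λ A → cong (λ t → (size A ≡ᵇ 0) ∧ (t <ᵇ m)) (rank0-false∷ k A)) (allSubsets k)) ⟩
    count (λ A → (size A ≡ᵇ 0) ∧ (rank k 0 A <ᵇ m)) (allSubsets k)
      ≡⟨ count-rank< k zero m ⟩
    m ⊓ (k C 0)
      ≡⟨ cong (m ⊓_) (trans (nC0≡1 k) (sym (nC0≡1 (suc k)))) ⟩
    m ⊓ (suc k C 0) ∎
    where open ≡-Reasoning
  count-rank< (suc k) (suc s) m = begin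
    count (λ A → (size A ≡ᵇ suc s) ∧ (rank (suc k) (suc s) A <ᵇ m)) (allSubsets (suc k))
      ≡⟨ count-allSubsets-suc k _ ⟩
    count (λ A → (size A ≡ᵇ s) ∧ (rank (suc k) (suc s) (true ∷ A) <ᵇ m)) (allSubsets k)
      + count (λ A → (size A ≡ᵇ suc s) ∧ (rank (suc k) (suc s) (false ∷ A) <ᵇ m)) (allSubsets k)
      ≡⟨ cong₂ _+_ containing-first avoiding-first ⟩
    m ⊓ (k C s) + (m ∸ k C s) ⊓ (k C suc s)
      ≡⟨ m⊓c+[m∸c]⊓d≡m⊓[c+d] m (k C s) (k C suc s) ⟩
    m ⊓ (k C s + k C suc s)
      ≡⟨ cong (m ⊓_) (nCk+nC[k+1]≡[n+1]C[k+1] k s) ⟩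
    m ⊓ (suc k C suc s) ∎
    where
    open ≡-Reasoning
    containing-first : count (λ A → (size A ≡ᵇ s) ∧ (rank (suc k) (suc s) (true ∷ A) <ᵇ m)) (allSubsets k) ≡ m ⊓ (k C s)
    containing-first = trans (count-cong (λ A → cong (λ t → (size A ≡ᵇ s) ∧ (t <ᵇ m)) (rank-true∷ k s A)) (allSubsets k))
                       (count-rank< k s m)
    avoiding-first : count (λ A → (size A ≡ᵇ suc s) ∧ (rank (suc k) (suc s) (false ∷ A) <ᵇ m)) (allSubsets k)
              ≡ (m ∸ k C s) ⊓ (k C suc s)
    avoiding-first = trans (count-cong (λ A → cong ((size A ≡ᵇ suc s) ∧_)
                        (trans (cong (_<ᵇ m) (rank-false∷ k s A)) (c+x<ᵇm≡x<ᵇm∸c (k C s) (rank k (suc s) A) m))) (allSubsets k))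
                      (count-rank< k (suc s) (m ∸ k C s))

  inI⇒ : ∀ {k r m} (A : Face k) → T (inI k r m A) → size A ≡ suc r × rank k (suc r) A < m
  inI⇒ {k} {r} {m} A t = let (e , lt) = T-∧ {size A ≡ᵇ suc r} .to t in ≡ᵇ⇒≡ _ _ e , <ᵇ⇒< _ _ lt

  inI⇐ : ∀ {k r m} (A : Face k) → size A ≡ suc r → rank k (suc r) A < m → T (inI k r m A)
  inI⇐ A e lt = T-∧ .from (≡⇒≡ᵇ _ _ e , <⇒<ᵇ lt)

  count-inI : ∀ k r m → count (inI k r m) (allSubsets k) ≡ m ⊓ (k C suc r)
  count-inI k r m = count-rank< k (suc r) m

  inI-mono : ∀ {k r m m′} → m ≤ m′ → (A : Face k) → T (inI k r m A) → T (inI k r m′ A)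
  inI-mono {k} {r} {m} m≤m′ A t = let (e , lt) = inI⇒ {k} {r} {m} A t in inI⇐ A e (<-≤-trans lt m≤m′)

  inI-downward : ∀ {k r m} (A B : Face k) → size B ≡ suc r → T (lexLE B A) → T (inI k r m A) → T (inI k r m B)
  inI-downward {k} {r} {m} A B e B≤A t =
    let (_ , lt) = inI⇒ {k} {r} {m} A t in inI⇐ B e (≤-<-trans (rank-mono-≤ k (suc r) B A e B≤A) lt)

  -- Augmented shadows

  shadowCond-covers : ∀ {k} (H L F : Face k) → T (lexLE H L) → T (covers H F) → T (shadowCond L F)
  shadowCond-covers [] [] [] _ _ = tt
  shadowCond-covers H (false ∷ L) F _ _ = tt
  shadowCond-covers (true ∷ H) (true ∷ L) (true ∷ F) _ _ = tt
  shadowCond-covers (true ∷ H) (true ∷ L) (false ∷ F) H≤L c =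
    let (F⊆H , e) = covers⇒ (true ∷ H) (false ∷ F) c
    in subst (λ X → T (lexLE (false ∷ X) (false ∷ L))) (sym (⊆∧size≡⇒≡ F H F⊆H (sym (suc-injective e)))) H≤L
  shadowCond-covers (false ∷ H) (true ∷ L) F () c

  shadowCond-downward : ∀ {k} (L F B : Face k) → T (shadowCond L F) → T (lexLE B F) → T (shadowCond L B)
  shadowCond-downward [] F B _ _ = tt
  shadowCond-downward (false ∷ L) F B _ _ = tt
  shadowCond-downward (true ∷ L) F B t B≤F = lex≤-trans B F (false ∷ L) B≤F t

  inShadow⇒ : ∀ k r m (F : Face k) → T (inShadow k r m F) →
    1 ≤ m × size F ≡ r × Σ[ L ∈ Face k ] size L ≡ suc r × rank k (suc r) L ≡ m ∸ 1 × T (shadowCond L F)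
  inShadow⇒ k r m F t =
    let (1≤m , t′)  = T-∧ {1 ≤ᵇ m} .to t
        (eF , t″)   = T-∧ {size F ≡ᵇ r} .to t′
        (L , tL)    = any-sound (allSubsets k) t″
        (last , sc) = T-∧ {isLast k r m L} .to tL
        (eL , rL)   = T-∧ {size L ≡ᵇ suc r} .to last
    in ≤ᵇ⇒≤ 1 m 1≤m , ≡ᵇ⇒≡ _ _ eF , L , ≡ᵇ⇒≡ _ _ eL , ≡ᵇ⇒≡ _ _ rL , sc

  inShadow⇐ : ∀ k r m (F L : Face k) → 1 ≤ m → size F ≡ r → size L ≡ suc r → rank k (suc r) L ≡ m ∸ 1 →
    T (shadowCond L F) → T (inShadow k r m F)
  inShadow⇐ k r m F L 1≤m eF eL rL sc =
    T-∧ .from (≤⇒≤ᵇ 1≤m , T-∧ .from (≡⇒≡ᵇ _ _ eF ,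
      any-allSubsets k L (T-∧ {isLast k r m L} .from (T-∧ .from (≡⇒≡ᵇ _ _ eL , ≡⇒≡ᵇ _ _ rL) , sc))))

  m∸1<m : ∀ {m} → 1 ≤ m → m ∸ 1 < m
  m∸1<m {suc m} _ = n<1+n m

  <⇒≤∸1 : ∀ {x m} → x < m → x ≤ m ∸ 1
  <⇒≤∸1 {m = suc m} (s≤s x≤m) = x≤m

  facet-inShadow : ∀ k r m → m ≤ k C suc r → (H F : Face k) → T (inI k r m H) → T (covers H F) → T (inShadow k r m F)
  facet-inShadow k r m m≤ H F tH c =
    let (eH , rH)     = inI⇒ {k} {r} {m} H tH
        1≤m           = ≤-trans (s≤s z≤n) rH
        (L , eL , rL) = unrank k (suc r) (m ∸ 1) (<-≤-trans (m∸1<m 1≤m) m≤)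
        H≤L           = rank-cancel-≤ k (suc r) H L eH eL (subst (rank k (suc r) H ≤_) (sym rL) (<⇒≤∸1 rH))
    in inShadow⇐ k r m F L 1≤m (facet-size H F c eH) eL rL (shadowCond-covers H L F H≤L c)

  inShadow⇒rank<shadowSize : ∀ k r m (F : Face k) → T (inShadow k r m F) → rank k r F < shadowSize k r m
  inShadow⇒rank<shadowSize k r m F tF =
    count-allSubsets-mono-< k below-F⇒inShadow F tF (λ t → lex<-irrefl F (proj₂ (T-∧ {size F ≡ᵇ r} .to t)))
    where
    below-F⇒inShadow : ∀ B → T ((size B ≡ᵇ r) ∧ lexLT B F) → T (inShadow k r m B)
    below-F⇒inShadow B t =
      let (eB , B<F) = T-∧ {size B ≡ᵇ r} .to t
          (1≤m , _ , L , eL , rL , sc) = inShadow⇒ k r m F tF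
      in inShadow⇐ k r m B L 1≤m (≡ᵇ⇒≡ _ _ eB) eL rL (shadowCond-downward L F B sc (lex<⇒lex≤ B F B<F))

  facet-inI-shadowSize : ∀ k r m c → m ≤ k C suc (suc r) → shadowSize k (suc r) m ≤ c →
    (H F : Face k) → T (inI k (suc r) m H) → T (covers H F) → T (inI k r c F)
  facet-inI-shadowSize k r m c m≤ ∂≤c H F tH cv =
    let tF = facet-inShadow k (suc r) m m≤ H F tH cv
        (_ , eF , _) = inShadow⇒ k (suc r) m F tF
    in inI⇐ F eF (<-≤-trans (inShadow⇒rank<shadowSize k (suc r) m F tF) ∂≤c)

  add-vertex : ∀ {k} (a : Face k) → size a < k → Σ[ b ∈ Face k ] T (covers b a)
  add-vertex (false ∷ a) _ = true ∷ a , covers-true∷ a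
  add-vertex (true ∷ a) (s≤s lt) = let (b , c) = add-vertex a lt in true ∷ b , c

  cofacet-through-first : ∀ {k} (F : Face (suc k)) → size F ≤ k → Σ[ H ∈ Face k ] T (covers (true ∷ H) F)
  cofacet-through-first (false ∷ F) _  = F , covers-true∷ F
  cofacet-through-first (true ∷ F)  lt = add-vertex F lt

  -- If the last element L of I(k, r + 1, m) contains the minimum, F lies below the facet of L
  -- without it; otherwise F is a facet of some H through the minimum, and H precedes L.
  shadowSize≤ : ∀ k r m c → (∀ H F → T (inI k (suc r) m H) → T (covers H F) → T (inI k r c F)) →
    shadowSize k (suc r) m ≤ c
  shadowSize≤ k r m c facets =
    ≤-trans (count-mono inShadow⇒inI (allSubsets k)) (subst (_≤ c) (sym (count-inI k r c)) (m⊓n≤m c _))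
    where
    inShadow⇒inI : ∀ F → T (inShadow k (suc r) m F) → T (inI k r c F)
    inShadow⇒inI F t with inShadow⇒ k (suc r) m F t
    ... | 1≤m , eF , true ∷ L , eL , rL , F≤L∖min =
      let last∈I = inI⇐ (true ∷ L) eL (subst (_< m) (sym rL) (m∸1<m 1≤m))
      in inI-downward {m = c} (false ∷ L) F eF F≤L∖min (facets (true ∷ L) (false ∷ L) last∈I (covers-true∷ L))
    ... | 1≤m , eF , false ∷ L , eL , rL , _ =
      let size-F<size-L = subst₂ _<_ (sym eF) (sym eL) (n<1+n (suc r))
          (H , cv) = cofacet-through-first F (<⇒≤ (<-≤-trans size-F<size-L (size≤ L)))
          eH = trans (proj₂ (covers⇒ (true ∷ H) F cv)) (cong suc eF)
          H<L = rank-mono-< _ (suc (suc r)) (true ∷ H) (false ∷ L) eH tt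
      in facets (true ∷ H) F (inI⇐ (true ∷ H) eH (<-≤-trans H<L (≤-trans (≤-reflexive rL) (<⇒≤ (m∸1<m 1≤m))))) cv

module EulerCharacteristic where

  open import Data.Nat using (zero; _⊔_; _<_; s≤s; _<?_)
  open import Data.Nat.Properties using (≮⇒≥; ≤-trans; n≤1+n; m≤m⊔n; m≤n⊔m)
  open import Data.Integer using (ℤ; _-_)
  open import Data.List using ([]; _∷_; drop; applyUpTo; length)
  open import Data.List.Properties using (map-applyUpTo)
  open import Relation.Binary.PropositionalEquality
  open import Relation.Nullary using (yes; no)

  f-β : List ℕ → List ℕ → ℕ → ℤ
  f-β f β j = + get f j - + get β j

  drop-applyUpTo-< : ∀ {a} {A : Set a} (h : ℕ → A) n r → r < n →
    drop r (applyUpTo h n) ≡ h r ∷ drop (suc r) (applyUpTo h n)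
  drop-applyUpTo-< h (suc n) zero    _        = refl
  drop-applyUpTo-< h (suc n) (suc r) (s≤s lt) = drop-applyUpTo-< (λ j → h (suc j)) n r lt

  drop-applyUpTo-≥ : ∀ {a} {A : Set a} (h : ℕ → A) n r → n ≤ r → drop r (applyUpTo h n) ≡ []
  drop-applyUpTo-≥ h zero    zero    _        = refl
  drop-applyUpTo-≥ h zero    (suc r) _        = refl
  drop-applyUpTo-≥ h (suc n) (suc r) (s≤s le) = drop-applyUpTo-≥ (λ j → h (suc j)) n r le

  get-≥length : ∀ xs r → length xs ≤ r → get xs r ≡ 0
  get-≥length []       r       _        = refl
  get-≥length (x ∷ xs) (suc r) (s≤s le) = get-≥length xs r le

  chiShift-step : ∀ f β r → chiShift f β r ≡ f-β f β r - chiShift f β (suc r)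
  chiShift-step f β r rewrite map-applyUpTo (λ j → j) (f-β f β) (length f ⊔ length β) with r <? length f ⊔ length β
  ... | yes r<n rewrite drop-applyUpTo-< (f-β f β) _ r r<n = refl
  ... | no  r≮n rewrite drop-applyUpTo-≥ (f-β f β) _ r (≮⇒≥ r≮n)
                      | drop-applyUpTo-≥ (f-β f β) _ (suc r) (≤-trans (≮⇒≥ r≮n) (n≤1+n r))
                      | get-≥length f r (≤-trans (m≤m⊔n (length f) (length β)) (≮⇒≥ r≮n))
                      | get-≥length β r (≤-trans (m≤n⊔m (length f) (length β)) (≮⇒≥ r≮n)) = refl

module Construction (f β : List ℕ) (n′ : ℕ)
  (χ≥0 : ∀ r → + 0 ≤ℤ chi f β r)
  (mE≤ : ∀ r → mE f β r ≤ n′ C suc r) where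

  open SubsetCombinatorics
  open EulerCharacteristic using (f-β; chiShift-step)
  open import Data.Nat using (zero; _+_; _∸_; _≡ᵇ_; z≤n; s≤s)
  open import Data.Nat.Properties using (≤-trans; m≤m+n; m≤n⇒m⊓n≡m; m+[n∸m]≡n; 0≢1+n; ≡ᵇ⇒≡; ≡⇒≡ᵇ)
  open import Data.Integer using (_-_; +≤+) renaming (_+_ to _+ℤ_)
  open import Data.Integer.Properties using (0≤i⇒+∣i∣≡i; pos-+; +-injective; drop‿+≤+)
  open import Data.Integer.Solver using (module +-*-Solver)
  open import Data.Bool using (Bool; true; false; _∧_; not; T)
  open import Data.Bool.Properties using (T-∧; T-∨)
  open import Data.Vec using (_∷_)
  open import Data.Product using (proj₁; proj₂)
  open import Data.Sum using (inj₁; inj₂)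
  open import Data.Empty using (⊥-elim)
  open import Relation.Binary.PropositionalEquality

  K : Face (suc n′) → Bool
  K = Kfβ f β n′

  chi≡mC : ∀ r → chi f β r ≡ + mC f β r
  chi≡mC r = sym (0≤i⇒+∣i∣≡i (χ≥0 r))

  f[1+r]≡mC+mE : ∀ r → get f (suc r) ≡ mC f β r + mE f β (suc r)
  f[1+r]≡mC+mE r = +-injective (begin
    + get f (suc r)
      ≡⟨ rearrange (+ get f (suc r)) (+ get β (suc r)) (chi f β (suc r)) ⟩
    (f-β f β (suc r) - chi f β (suc r)) +ℤ (chi f β (suc r) +ℤ + get β (suc r))
      ≡⟨ cong₂ (λ x y → x +ℤ (y +ℤ + get β (suc r))) (sym (chiShift-step f β (suc r))) (chi≡mC (suc r)) ⟩
    chi f β r +ℤ (+ mC f β (suc r) +ℤ + get β (suc r))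
      ≡⟨ cong₂ _+ℤ_ (chi≡mC r) (sym (pos-+ (mC f β (suc r)) (get β (suc r)))) ⟩
    + mC f β r +ℤ + mE f β (suc r)
      ≡⟨ sym (pos-+ (mC f β r) (mE f β (suc r))) ⟩
    + (mC f β r + mE f β (suc r)) ∎)
    where
    open ≡-Reasoning
    open +-*-Solver
    rearrange : ∀ a b y → a ≡ ((a - b) - y) +ℤ (y +ℤ b)
    rearrange = solve 3 (λ a b y → a := ((a :- b) :- y) :+ (y :+ b)) refl

  chiShift0≡f0-mE0 : chiShift f β 0 ≡ + get f 0 - + mE f β 0
  chiShift0≡f0-mE0 = begin
    chiShift f β 0
      ≡⟨ chiShift-step f β 0 ⟩
    (+ get f 0 - + get β 0) - chi f β 0
      ≡⟨ cong ((+ get f 0 - + get β 0) -_) (chi≡mC 0) ⟩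
    (+ get f 0 - + get β 0) - + mC f β 0
      ≡⟨ rearrange (+ get f 0) (+ get β 0) (+ mC f β 0) ⟩
    + get f 0 - (+ mC f β 0 +ℤ + get β 0)
      ≡⟨ cong (+ get f 0 -_) (sym (pos-+ (mC f β 0) (get β 0))) ⟩
    + get f 0 - + mE f β 0 ∎
    where
    open ≡-Reasoning
    open +-*-Solver
    rearrange : ∀ a b c → (a - b) - c ≡ a - (c +ℤ b)
    rearrange = solve 3 (λ a b c → (a :- b) :- c := a :- (c :+ b)) refl

  f0≡1+mE0⇔χ₋₁≡1 : get f 0 ≡ 1 + mE f β 0 ⇔ chiShift f β 0 ≡ + 1
  f0≡1+mE0⇔χ₋₁≡1 = mk⇔ to′ from′
    where
    open +-*-Solver
    to′ : get f 0 ≡ 1 + mE f β 0 → chiShift f β 0 ≡ + 1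
    to′ e = trans chiShift0≡f0-mE0 (trans (cong (λ x → + x - + mE f β 0) e)
              (trans (cong (_- + mE f β 0) (pos-+ 1 (mE f β 0)))
                     (solve 1 (λ x → (con (+ 1) :+ x) :- x := con (+ 1)) refl (+ mE f β 0))))
    from′ : chiShift f β 0 ≡ + 1 → get f 0 ≡ 1 + mE f β 0
    from′ e = +-injective (trans (solve 2 (λ a x → a := (a :- x) :+ x) refl (+ get f 0) (+ mE f β 0))
                (trans (cong (_+ℤ + mE f β 0) (trans (sym chiShift0≡f0-mE0) e)) (sym (pos-+ 1 (mE f β 0)))))

  inC-at : ∀ {r} (a : Face n′) → size a ≡ suc r → inC f β n′ a ≡ inI n′ r (mC f β r) a
  inC-at a e = cong (λ s → inI n′ (s ∸ 1) (mC f β (s ∸ 1)) a) e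

  inE-at : ∀ {r} (a : Face n′) → size a ≡ suc r → inE f β n′ a ≡ inI n′ r (mE f β r) a
  inE-at a e = cong (λ s → inI n′ (s ∸ 1) (mE f β (s ∸ 1)) a) e

  C⊆E : (a : Face n′) → T (inC f β n′ a) → T (inE f β n′ a)
  C⊆E a = inI-mono {n′} {size a ∸ 1} (m≤m+n (mC f β (size a ∸ 1)) (get β (size a ∸ 1))) a

  K-base⇒inE : (a : Face n′) → T (K (false ∷ a)) → T (inE f β n′ a)
  K-base⇒inE a t with T-∨ {inC f β n′ a} .to t
  ... | inj₁ a∈C = C⊆E a a∈C
  ... | inj₂ a∈E = a∈E

  inE⇒K-base : (a : Face n′) → T (inE f β n′ a) → T (K (false ∷ a))
  inE⇒K-base a a∈E = T-∨ {inC f β n′ a} .from (inj₂ a∈E)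

  inC⇒K-apex : (a : Face n′) → T (inC f β n′ a) → T (K (true ∷ a))
  inC⇒K-apex a a∈C = T-∨ {isEmpty a} .from (inj₂ a∈C)

  module UnderShadowBound (∂≤χ : ∀ r → shadowSize n′ (suc r) (mE f β (suc r)) ≤ mC f β r) where

    facet-of-E-inC : (a b : Face n′) → T (inE f β n′ a) → T (covers a b) → T (not (isEmpty b)) → T (inC f β n′ b)
    facet-of-E-inC a b a∈E c b≢∅ =
      subst T (sym (inC-at b eb))
        (facet-inI-shadowSize n′ r (mE f β (suc r)) (mC f β r) (mE≤ (suc r)) (∂≤χ r)
           a b (subst T (inE-at a ea) a∈E) c)
      where
      r : ℕ
      r = size b ∸ 1
      eb : size b ≡ suc r
      eb = sym (m+[n∸m]≡n (nonempty⇒1≤size b b≢∅))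
      ea : size a ≡ suc (suc r)
      ea = trans (proj₂ (covers⇒ a b c)) (cong suc eb)

    C-⊆-closed : ∀ a b → T (inC f β n′ a) → T (subsetOf b a) → T (not (isEmpty b)) → T (inC f β n′ b)
    C-⊆-closed = facet-closed⇒⊆-closed (λ x → T (inC f β n′ x)) (λ a b a∈C → facet-of-E-inC a b (C⊆E a a∈C))

    E-⊆-closed : ∀ a b → T (inE f β n′ a) → T (subsetOf b a) → T (not (isEmpty b)) → T (inE f β n′ b)
    E-⊆-closed = facet-closed⇒⊆-closed (λ x → T (inE f β n′ x))
                   (λ a b a∈E c b≢∅ → C⊆E b (facet-of-E-inC a b a∈E c b≢∅))

    K-isSimplicialComplex : IsSimplicialComplex K
    K-isSimplicialComplex (true ∷ a) (true ∷ b) tK b⊆a _ with empty⊎nonempty b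
    ... | inj₁ b-empty = T-∨ .from (inj₁ b-empty)
    ... | inj₂ b≢∅ with T-∨ {isEmpty a} .to tK
    ...   | inj₁ a-empty = ⊥-elim (empty⇒¬nonempty b (⊆-empty b a b⊆a a-empty) b≢∅)
    ...   | inj₂ a∈C     = inC⇒K-apex b (C-⊆-closed a b a∈C b⊆a b≢∅)
    K-isSimplicialComplex (true ∷ a) (false ∷ b) tK b⊆a b≢∅ with T-∨ {isEmpty a} .to tK
    ... | inj₁ a-empty = ⊥-elim (empty⇒¬nonempty b (⊆-empty b a b⊆a a-empty) b≢∅)
    ... | inj₂ a∈C     = inE⇒K-base b (C⊆E b (C-⊆-closed a b a∈C b⊆a b≢∅))
    K-isSimplicialComplex (false ∷ a) (false ∷ b) tK b⊆a b≢∅ =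
      inE⇒K-base b (E-⊆-closed a b (K-base⇒inE a tK) b⊆a b≢∅)

  count-inI≡ : ∀ r m → m ≤ n′ C suc r → count (inI n′ r m) (allSubsets n′) ≡ m
  count-inI≡ r m m≤ = trans (count-inI n′ r m) (m≤n⇒m⊓n≡m m≤)

  count-base-faces : ∀ r → count (λ a → K (false ∷ a) ∧ (size a ≡ᵇ suc r)) (allSubsets n′) ≡ mE f β r
  count-base-faces r = trans (count-cong-T to′ from′ (allSubsets n′)) (count-inI≡ r (mE f β r) (mE≤ r))
    where
    to′ : ∀ a → T (K (false ∷ a) ∧ (size a ≡ᵇ suc r)) → T (inI n′ r (mE f β r) a)
    to′ a t = let (tK , e) = T-∧ {K (false ∷ a)} .to t in subst T (inE-at a (≡ᵇ⇒≡ _ _ e)) (K-base⇒inE a tK)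
    from′ : ∀ a → T (inI n′ r (mE f β r) a) → T (K (false ∷ a) ∧ (size a ≡ᵇ suc r))
    from′ a t = let e = proj₁ (inI⇒ {n′} {r} {mE f β r} a t) in
      T-∧ {K (false ∷ a)} .from (inE⇒K-base a (subst T (sym (inE-at a e)) t) , ≡⇒≡ᵇ _ _ e)

  count-apex-vertex : count (λ a → K (true ∷ a) ∧ (size a ≡ᵇ 0)) (allSubsets n′) ≡ 1
  count-apex-vertex = begin
    count (λ a → K (true ∷ a) ∧ (size a ≡ᵇ 0)) (allSubsets n′)
      ≡⟨ count-cong-T (λ a t → proj₂ (T-∧ {K (true ∷ a)} .to t))
                      (λ a t → T-∧ .from (T-∨ .from (inj₁ t) , t)) (allSubsets n′) ⟩
    count (λ a → size a ≡ᵇ 0) (allSubsets n′)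
      ≡⟨ count-size≡ n′ 0 ⟩
    n′ C 0
      ≡⟨ nC0≡1 n′ ⟩
    1 ∎
    where open ≡-Reasoning

  count-apex-faces : ∀ r → count (λ a → K (true ∷ a) ∧ (size a ≡ᵇ suc r)) (allSubsets n′) ≡ mC f β r
  count-apex-faces r =
    trans (count-cong-T to′ from′ (allSubsets n′)) (count-inI≡ r (mC f β r) (≤-trans (m≤m+n _ _) (mE≤ r)))
    where
    to′ : ∀ a → T (K (true ∷ a) ∧ (size a ≡ᵇ suc r)) → T (inI n′ r (mC f β r) a)
    to′ a t with T-∧ {K (true ∷ a)} .to t
    ... | tK , e with T-∨ {isEmpty a} .to tK
    ...   | inj₁ a-empty = ⊥-elim (0≢1+n (trans (sym (≡ᵇ⇒≡ (size a) 0 a-empty)) (≡ᵇ⇒≡ _ _ e)))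
    ...   | inj₂ a∈C     = subst T (inC-at a (≡ᵇ⇒≡ _ _ e)) a∈C
    from′ : ∀ a → T (inI n′ r (mC f β r) a) → T (K (true ∷ a) ∧ (size a ≡ᵇ suc r))
    from′ a t = let e = proj₁ (inI⇒ {n′} {r} {mC f β r} a t) in
      T-∧ {K (true ∷ a)} .from (inC⇒K-apex a (subst T (sym (inC-at a e)) t) , ≡⇒≡ᵇ _ _ e)

  fVec-zero : fVec K 0 ≡ 1 + mE f β 0
  fVec-zero = trans (count-allSubsets-suc n′ _) (cong₂ _+_ count-apex-vertex (count-base-faces 0))

  fVec-suc : ∀ r → fVec K (suc r) ≡ mC f β r + mE f β (suc r)
  fVec-suc r = trans (count-allSubsets-suc n′ _) (cong₂ _+_ (count-apex-faces r) (count-base-faces (suc r)))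

  fVec≡f⇔χ₋₁≡1 : (∀ r → fVec K r ≡ get f r) ⇔ chiShift f β 0 ≡ + 1
  fVec≡f⇔χ₋₁≡1 = mk⇔
    (λ fVec≡f → f0≡1+mE0⇔χ₋₁≡1 .to (trans (sym (fVec≡f 0)) fVec-zero))
    (λ χ₋₁≡1 → λ { zero    → trans fVec-zero (sym (f0≡1+mE0⇔χ₋₁≡1 .from χ₋₁≡1))
                 ; (suc r) → trans (fVec-suc r) (sym (f[1+r]≡mC+mE r)) })

  shadow-bound-ℤ⇔ℕ : (∀ r → 1 ≤ r → + shadowSize n′ r (mE f β r) ≤ℤ chiShift f β r)
                   ⇔ (∀ r → shadowSize n′ (suc r) (mE f β (suc r)) ≤ mC f β r)
  shadow-bound-ℤ⇔ℕ = mk⇔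
    (λ ∂≤χ r → drop‿+≤+ (subst (+ ∂ (suc r) ≤ℤ_) (chi≡mC r) (∂≤χ (suc r) (s≤s z≤n))))
    (λ { ∂≤χ (suc r) _ → subst (+ ∂ (suc r) ≤ℤ_) (sym (chi≡mC r)) (+≤+ (∂≤χ r)) })
    where
    ∂ : ℕ → ℕ
    ∂ r = shadowSize n′ r (mE f β r)

module Chains {c ℓ} (F : Field c ℓ) where

  open SubsetCombinatorics using (covers; eqF-refl; eqF⇒≡; ⊆⇒size≤)
  open import Level using (_⊔_)
  open import Algebra.Bundles using (CommutativeRing)
  open import Data.Nat using (zero; _<_; _≡ᵇ_; s≤s)
  open import Data.Nat.Properties using (m≤n⇒m≤1+n)
  open import Data.Bool using (Bool; true; false; _∧_; not; if_then_else_; T)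
  open import Data.Vec using ([]; _∷_)
  open import Data.List using ([]; _∷_; map; _++_)
  open import Data.List.Properties using (map-++; map-∘)
  open import Data.Fin as Fin using (Fin; punchIn)
  open import Data.Vec.Functional using (insertAt)
  open import Data.Vec.Functional.Properties using (insertAt-lookup; insertAt-punchIn)
  open import Data.Product using (Σ-syntax; proj₁; proj₂)
  open import Data.Sum using (_⊎_; inj₁; inj₂)
  open import Data.Empty using (⊥-elim)
  import Relation.Binary.PropositionalEquality as ≡
  open import Relation.Nullary using (¬_; yes; no)
  open import Relation.Nullary.Decidable using (¬¬-excluded-middle)

  open Field F using (commutativeRing; 1≉0; inverse)
  open CommutativeRing commutativeRing hiding (zero)
  open import Algebra.Properties.Ring ring using (-0#≈0#; -‿+-comm; -‿involutive; -‿distribˡ-*; -‿distribʳ-*; -1*x≈-x; \\-leftDividesʳ; +-inverseˡ-unique)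
  open import Algebra.Properties.CommutativeSemigroup +-commutativeSemigroup using (interchange)
  open import Algebra.Properties.Semiring.Sum semiring using (sum; sum-cong-≋; sum-replicate-zero; ∑-distrib-+; *-distribʳ-sum; sum-remove)
  open Homology F hiding (covers)
  open import Relation.Binary.Reasoning.Setoid setoid

  sumL-++ : ∀ xs ys → sumL (xs ++ ys) ≈ sumL xs + sumL ys
  sumL-++ [] ys = sym (+-identityˡ _)
  sumL-++ (x ∷ xs) ys = trans (+-congˡ (sumL-++ xs ys)) (sym (+-assoc x _ _))

  sumL-map-cong : ∀ {A : Set} {g h : A → Carrier} xs → (∀ x → g x ≈ h x) → sumL (map g xs) ≈ sumL (map h xs)
  sumL-map-cong [] e = refl
  sumL-map-cong (x ∷ xs) e = +-cong (e x) (sumL-map-cong xs e)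

  sumL-map-zero : ∀ {A : Set} {g : A → Carrier} xs → (∀ x → g x ≈ 0#) → sumL (map g xs) ≈ 0#
  sumL-map-zero [] e = refl
  sumL-map-zero (x ∷ xs) e = trans (+-cong (e x) (sumL-map-zero xs e)) (+-identityʳ 0#)

  sumL-map-neg : ∀ {A : Set} (g : A → Carrier) xs → sumL (map (λ x → - g x) xs) ≈ - sumL (map g xs)
  sumL-map-neg g [] = sym -0#≈0#
  sumL-map-neg g (x ∷ xs) = trans (+-congˡ (sumL-map-neg g xs)) (-‿+-comm _ _)

  sumSubsets : ∀ n → (Face n → Carrier) → Carrier
  sumSubsets n g = sumL (map g (allSubsets n))

  sumSubsets-suc : ∀ n (g : Face (suc n) → Carrier) →
    sumSubsets (suc n) g ≈ sumSubsets n (λ a → g (true ∷ a)) + sumSubsets n (λ a → g (false ∷ a))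
  sumSubsets-suc n g = begin
    sumL (map g (map (true ∷_) S ++ map (false ∷_) S))
      ≡⟨ ≡.cong sumL (map-++ g (map (true ∷_) S) (map (false ∷_) S)) ⟩
    sumL (map g (map (true ∷_) S) ++ map g (map (false ∷_) S))
      ≈⟨ sumL-++ (map g (map (true ∷_) S)) _ ⟩
    sumL (map g (map (true ∷_) S)) + sumL (map g (map (false ∷_) S))
      ≡⟨ ≡.cong₂ _+_ (≡.cong sumL (≡.sym (map-∘ S))) (≡.cong sumL (≡.sym (map-∘ S))) ⟩
    sumSubsets n (λ a → g (true ∷ a)) + sumSubsets n (λ a → g (false ∷ a)) ∎
    where
    S : List (Face n)
    S = allSubsets n

  sumSubsets-indicator : ∀ n (b : Face n) (g : Face n → Carrier) →
    sumSubsets n (λ a → if eqF a b then g a else 0#) ≈ g b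
  sumSubsets-indicator zero [] g = +-identityʳ (g [])
  sumSubsets-indicator (suc n) (true ∷ b) g = begin
    sumSubsets (suc n) _
      ≈⟨ sumSubsets-suc n _ ⟩
    _ + _
      ≈⟨ +-cong (sumSubsets-indicator n b (λ a → g (true ∷ a))) (sumL-map-zero (allSubsets n) (λ _ → refl)) ⟩
    g (true ∷ b) + 0#
      ≈⟨ +-identityʳ _ ⟩
    g (true ∷ b) ∎
  sumSubsets-indicator (suc n) (false ∷ b) g = begin
    sumSubsets (suc n) _
      ≈⟨ sumSubsets-suc n _ ⟩
    _ + _
      ≈⟨ +-cong (sumL-map-zero (allSubsets n) (λ _ → refl)) (sumSubsets-indicator n b (λ a → g (false ∷ a))) ⟩
    0# + g (false ∷ b)
      ≈⟨ +-identityˡ _ ⟩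
    g (false ∷ b) ∎

  sum-zero : ∀ {b} {g : Fin b → Carrier} → (∀ i → g i ≈ 0#) → sum g ≈ 0#
  sum-zero {b} g≈0 = trans (sum-cong-≋ g≈0) (sum-replicate-zero b)

  sum-neg : ∀ {b} (g : Fin b → Carrier) → sum (λ i → - g i) ≈ - sum g
  sum-neg {zero}  g = sym -0#≈0#
  sum-neg {suc b} g = trans (+-congˡ (sum-neg (λ i → g (Fin.suc i)))) (-‿+-comm _ _)

  sum-indicator : ∀ {b} (a d : Fin b → Carrier) (j : Fin b) → d j ≈ 1# → (∀ i → ¬ i ≡ j → d i ≈ 0#) →
    sum (λ i → a i * d i) ≈ a j
  sum-indicator {suc b} a d j dj≈1 d≈0 = begin
    sum (λ i → a i * d i)
      ≈⟨ sum-remove {i = j} (λ i → a i * d i) ⟩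
    a j * d j + sum (λ i → a (punchIn j i) * d (punchIn j i))
      ≈⟨ +-cong (trans (*-congˡ dj≈1) (*-identityʳ _))
                (sum-zero (λ i → trans (*-congˡ (d≈0 _ (punchInᵢ≢i j i))) (zeroʳ _))) ⟩
    a j + 0#
      ≈⟨ +-identityʳ _ ⟩
    a j ∎
    where open import Data.Fin.Properties using (punchInᵢ≢i)

  lin≈sum : ∀ {n} b (a : Fin b → Carrier) (z : Fin b → Chain n) A → lin b a z A ≈ sum (λ i → a i * z i A)
  lin≈sum zero    a z A = refl
  lin≈sum (suc b) a z A = +-congˡ (lin≈sum b (λ i → a (Fin.suc i)) (λ i → z (Fin.suc i)) A)

  -- The boundary operator of Defs recomputed by splitting off the first vertex (boundary≈∂),
  -- so that its algebra follows by induction on the number of vertices.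

  ∂ : ∀ {n} → Chain n → Chain n
  ∂ {zero}  x []          = 0#
  ∂ {suc n} x (true ∷ b)  = - ∂ (λ a → x (true ∷ a)) b
  ∂ {suc n} x (false ∷ b) = x (true ∷ b) + ∂ (λ a → x (false ∷ a)) b

  private
    suc≢ᵇ : ∀ m n → n ≤ m → (suc m ≡ᵇ n) ≡ false
    suc≢ᵇ m       zero    _        = ≡.refl
    suc≢ᵇ (suc m) (suc n) (s≤s le) = suc≢ᵇ m n le

    ⊆∧size≡ᵇ≡eqF : ∀ {n} (a b : Face n) → (subsetOf b a ∧ (size a ≡ᵇ size b)) ≡ eqF a b
    ⊆∧size≡ᵇ≡eqF [] [] = ≡.refl
    ⊆∧size≡ᵇ≡eqF (true ∷ a)  (true ∷ b)  = ⊆∧size≡ᵇ≡eqF a b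
    ⊆∧size≡ᵇ≡eqF (false ∷ a) (false ∷ b) = ⊆∧size≡ᵇ≡eqF a b
    ⊆∧size≡ᵇ≡eqF (false ∷ a) (true ∷ b)  = ≡.refl
    ⊆∧size≡ᵇ≡eqF (true ∷ a)  (false ∷ b) with subsetOf b a in b⊆a
    ... | false = ≡.refl
    ... | true  = suc≢ᵇ (size a) (size b) (⊆⇒size≤ b a (≡.subst T (≡.sym b⊆a) _))

    flip-sign : ∀ (c p : Bool) y →
      (if c then (if not p then - 1# else 1#) * y else 0#) ≈ - (if c then (if p then - 1# else 1#) * y else 0#)
    flip-sign false p     y = sym -0#≈0#
    flip-sign true  true  y = trans (*-identityˡ y) (trans (sym (-‿involutive y)) (-‿cong (sym (-1*x≈-x y))))
    flip-sign true  false y = trans (-1*x≈-x y) (-‿cong (sym (*-identityˡ y)))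

  boundary≈∂ : ∀ {n} (x : Chain n) B → boundary x B ≈ ∂ x B
  boundary≈∂ {zero} x [] = +-identityʳ 0#
  boundary≈∂ {suc n} x (true ∷ b) = begin
    boundary x (true ∷ b)
      ≈⟨ sumSubsets-suc n _ ⟩
    sumSubsets n (λ a → if covers a b then sgn (true ∷ a) (true ∷ b) * x (true ∷ a) else 0#) + sumSubsets n (λ _ → 0#)
      ≈⟨ +-cong (sumL-map-cong (allSubsets n) (λ a → flip-sign (covers a b) (parity a b) (x (true ∷ a))))
                (sumL-map-zero (allSubsets n) (λ _ → refl)) ⟩
    sumSubsets n (λ a → - (if covers a b then sgn a b * x (true ∷ a) else 0#)) + 0#
      ≈⟨ +-identityʳ _ ⟩
    sumSubsets n (λ a → - (if covers a b then sgn a b * x (true ∷ a) else 0#))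
      ≈⟨ sumL-map-neg _ (allSubsets n) ⟩
    - boundary (λ a → x (true ∷ a)) b
      ≈⟨ -‿cong (boundary≈∂ (λ a → x (true ∷ a)) b) ⟩
    - ∂ (λ a → x (true ∷ a)) b ∎
  boundary≈∂ {suc n} x (false ∷ b) = begin
    boundary x (false ∷ b)
      ≈⟨ sumSubsets-suc n _ ⟩
    sumSubsets n (λ a → if covers (true ∷ a) (false ∷ b) then sgn (true ∷ a) (false ∷ b) * x (true ∷ a) else 0#)
      + boundary (λ a → x (false ∷ a)) b
      ≈⟨ +-cong (sumL-map-cong (allSubsets n) cover-by-apex) (boundary≈∂ (λ a → x (false ∷ a)) b) ⟩
    sumSubsets n (λ a → if eqF a b then x (true ∷ a) else 0#) + ∂ (λ a → x (false ∷ a)) b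
      ≈⟨ +-congʳ (sumSubsets-indicator n b (λ a → x (true ∷ a))) ⟩
    x (true ∷ b) + ∂ (λ a → x (false ∷ a)) b ∎
    where
    cover-by-apex : ∀ a → (if covers (true ∷ a) (false ∷ b) then sgn (true ∷ a) (false ∷ b) * x (true ∷ a) else 0#)
                        ≈ (if eqF a b then x (true ∷ a) else 0#)
    cover-by-apex a rewrite ⊆∧size≡ᵇ≡eqF a b with eqF a b
    ... | true  = *-identityˡ _
    ... | false = refl

  ∂-cong : ∀ {n} {x y : Chain n} → (∀ A → x A ≈ y A) → ∀ B → ∂ x B ≈ ∂ y B
  ∂-cong {zero}  e []          = refl
  ∂-cong {suc n} e (true ∷ b)  = -‿cong (∂-cong (λ a → e (true ∷ a)) b)
  ∂-cong {suc n} e (false ∷ b) = +-cong (e (true ∷ b)) (∂-cong (λ a → e (false ∷ a)) b)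

  ∂-zero : ∀ {n} {x : Chain n} → (∀ A → x A ≈ 0#) → ∀ B → ∂ x B ≈ 0#
  ∂-zero {zero}  e []          = refl
  ∂-zero {suc n} e (true ∷ b)  = trans (-‿cong (∂-zero (λ a → e (true ∷ a)) b)) -0#≈0#
  ∂-zero {suc n} e (false ∷ b) = trans (+-cong (e (true ∷ b)) (∂-zero (λ a → e (false ∷ a)) b)) (+-identityʳ 0#)

  ∂-+ : ∀ {n} (x y : Chain n) B → ∂ (λ A → x A + y A) B ≈ ∂ x B + ∂ y B
  ∂-+ {zero}  x y [] = sym (+-identityʳ 0#)
  ∂-+ {suc n} x y (true ∷ b) =
    trans (-‿cong (∂-+ (λ a → x (true ∷ a)) (λ a → y (true ∷ a)) b)) (sym (-‿+-comm _ _))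
  ∂-+ {suc n} x y (false ∷ b) =
    trans (+-congˡ (∂-+ (λ a → x (false ∷ a)) (λ a → y (false ∷ a)) b)) (interchange _ _ _ _)

  ∂-* : ∀ {n} k (x : Chain n) B → ∂ (λ A → k * x A) B ≈ k * ∂ x B
  ∂-* {zero}  k x [] = sym (zeroʳ k)
  ∂-* {suc n} k x (true ∷ b)  = trans (-‿cong (∂-* k (λ a → x (true ∷ a)) b)) (-‿distribʳ-* k _)
  ∂-* {suc n} k x (false ∷ b) = trans (+-congˡ (∂-* k (λ a → x (false ∷ a)) b)) (sym (distribˡ k _ _))

  ∂-neg : ∀ {n} (x : Chain n) B → ∂ (λ A → - x A) B ≈ - ∂ x B
  ∂-neg x B = begin
    ∂ (λ A → - x A) B      ≈⟨ ∂-cong (λ A → sym (-1*x≈-x (x A))) B ⟩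
    ∂ (λ A → - 1# * x A) B ≈⟨ ∂-* (- 1#) x B ⟩
    - 1# * ∂ x B           ≈⟨ -1*x≈-x _ ⟩
    - ∂ x B                ∎

  ∂-lin : ∀ {n} b (a : Fin b → Carrier) (z : Fin b → Chain n) B → ∂ (lin b a z) B ≈ sum (λ i → a i * ∂ (z i) B)
  ∂-lin zero    a z B = ∂-zero (λ _ → refl) B
  ∂-lin {n} (suc b) a z B =
    trans (∂-+ (λ A → a Fin.zero * z Fin.zero A) (lin b a′ z′) B) (+-cong (∂-* (a Fin.zero) (z Fin.zero) B) (∂-lin b a′ z′ B))
    where
    a′ : Fin b → Carrier
    a′ i = a (Fin.suc i)
    z′ : Fin b → Chain n
    z′ i = z (Fin.suc i)

  ∂∘∂≈0 : ∀ {n} (x : Chain n) B → ∂ (∂ x) B ≈ 0#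
  ∂∘∂≈0 {zero} x [] = refl
  ∂∘∂≈0 {suc n} x (true ∷ b) = begin
    - ∂ (λ a → - ∂ xT a) b ≈⟨ -‿cong (∂-neg (∂ xT) b) ⟩
    - (- ∂ (∂ xT) b)       ≈⟨ -‿involutive _ ⟩
    ∂ (∂ xT) b             ≈⟨ ∂∘∂≈0 xT b ⟩
    0#                     ∎
    where
    xT : Chain n
    xT a = x (true ∷ a)
  ∂∘∂≈0 {suc n} x (false ∷ b) = begin
    - ∂ xT b + ∂ (λ a → xT a + ∂ xF a) b ≈⟨ +-congˡ (∂-+ xT (∂ xF) b) ⟩
    - ∂ xT b + (∂ xT b + ∂ (∂ xF) b)     ≈⟨ \\-leftDividesʳ (∂ xT b) _ ⟩
    ∂ (∂ xF) b                           ≈⟨ ∂∘∂≈0 xF b ⟩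
    0#                                   ∎
    where
    xT xF : Chain n
    xT a = x (true ∷ a)
    xF a = x (false ∷ a)

  ∂-support : ∀ {n} (x : Chain n) B → (∀ A → T (covers A B) → x A ≈ 0#) → ∂ x B ≈ 0#
  ∂-support {n} x B x≈0 = trans (sym (boundary≈∂ x B)) (sumL-map-zero (allSubsets n) term≈0)
    where
    term≈0 : ∀ A → (if covers A B then sgn A B * x A else 0#) ≈ 0#
    term≈0 A with covers A B in eq
    ... | true  = trans (*-congˡ (x≈0 A (≡.subst T (≡.sym eq) _))) (zeroʳ _)
    ... | false = refl

  δ : ∀ {n} → Face n → Chain n
  δ b a = if eqF a b then 1# else 0#

  δ-self : ∀ {n} (a : Face n) → δ a a ≈ 1#
  δ-self a with eqF a a in eq
  ... | true  = refl
  ... | false = ⊥-elim (≡.subst T eq (eqF-refl a))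

  δ-other : ∀ {n} (a b : Face n) → a ≡ b ⊎ δ b a ≈ 0#
  δ-other a b with eqF a b in eq
  ... | true  = inj₁ (eqF⇒≡ a b (≡.subst T (≡.sym eq) _))
  ... | false = inj₂ refl

  ∂δ-support : ∀ {n} (H B : Face n) → ¬ T (covers H B) → ∂ (δ H) B ≈ 0#
  ∂δ-support H B ¬cov = ∂-support (δ H) B δH≈0
    where
    δH≈0 : ∀ A → T (covers A B) → δ H A ≈ 0#
    δH≈0 A cov with δ-other A H
    ... | inj₁ ≡.refl = ⊥-elim (¬cov cov)
    ... | inj₂ δ≈0    = δ≈0

  ∂δ-facet : ∀ {n} (H F : Face n) → T (covers H F) → ∂ (δ H) F ≈ sgn H F
  ∂δ-facet {n} H F cov = begin
    ∂ (δ H) F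
      ≈⟨ sym (boundary≈∂ (δ H) F) ⟩
    sumSubsets n (λ A → if covers A F then sgn A F * δ H A else 0#)
      ≈⟨ sumL-map-cong (allSubsets n) only-H ⟩
    sumSubsets n (λ A → if eqF A H then sgn A F else 0#)
      ≈⟨ sumSubsets-indicator n H (λ A → sgn A F) ⟩
    sgn H F ∎
    where
    only-H : ∀ A → (if covers A F then sgn A F * δ H A else 0#) ≈ (if eqF A H then sgn A F else 0#)
    only-H A with eqF A H in eq
    ... | false with covers A F
    ...   | true  = zeroʳ _
    ...   | false = refl
    only-H A | true with eqF⇒≡ A H (≡.subst T (≡.sym eq) _)
    ... | ≡.refl with covers H F
    ...   | true  = *-identityʳ _
    ...   | false = ⊥-elim cov

  sgn-cancel : ∀ {n} (A B : Face n) a → a * sgn A B ≈ 0# → a ≈ 0#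
  sgn-cancel A B a e = begin
    a                       ≈⟨ sym (*-identityʳ a) ⟩
    a * 1#                  ≈⟨ *-congˡ (sym sgn²≈1) ⟩
    a * (sgn A B * sgn A B) ≈⟨ sym (*-assoc _ _ _) ⟩
    (a * sgn A B) * sgn A B ≈⟨ *-congʳ e ⟩
    0# * sgn A B            ≈⟨ zeroˡ _ ⟩
    0#                      ∎
    where
    sgn²≈1 : sgn A B * sgn A B ≈ 1#
    sgn²≈1 with parity A B
    ... | true  = trans (-1*x≈-x (- 1#)) (-‿involutive 1#)
    ... | false = *-identityˡ 1#

  withApex : ∀ {n} → Chain n → Chain n → Chain (suc n)
  withApex xT xF (true ∷ a)  = xT a
  withApex xT xF (false ∷ a) = xF a

  ∂-withApex-cycle : ∀ {n} (x : Chain n) B → ∂ (withApex (λ a → - ∂ x a) x) B ≈ 0#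
  ∂-withApex-cycle x (true ∷ b)  =
    trans (-‿cong (trans (∂-neg (∂ x) b) (-‿cong (∂∘∂≈0 x b)))) (trans (-‿cong -0#≈0#) -0#≈0#)
  ∂-withApex-cycle x (false ∷ b) = -‿inverseˡ (∂ x b)

  LinearlyIndependent : ∀ {b m} → (Fin m → Fin b → Carrier) → Set (c ⊔ ℓ)
  LinearlyIndependent {b} {m} v = ∀ (α : Fin m → Carrier) → (∀ t → sum (λ i → α i * v i t) ≈ 0#) → ∀ i → α i ≈ 0#

  ¬¬-∀⊎∃¬ : ∀ {p} m (P : Fin m → Set p) → ¬ ¬ ((∀ i → P i) ⊎ Σ[ i ∈ Fin m ] ¬ P i)
  ¬¬-∀⊎∃¬ zero    P k = k (inj₁ λ ())
  ¬¬-∀⊎∃¬ (suc m) P k = ¬¬-excluded-middle λ where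
    (no ¬p₀) → k (inj₂ (Fin.zero , ¬p₀))
    (yes p₀) → ¬¬-∀⊎∃¬ m (λ i → P (Fin.suc i)) λ where
      (inj₁ ∀p)       → k (inj₁ λ { Fin.zero → p₀ ; (Fin.suc i) → ∀p i })
      (inj₂ (i , ¬p)) → k (inj₂ (Fin.suc i , ¬p))

  dropFirstCoordinate-independent : ∀ {b m} (v : Fin m → Fin (suc b) → Carrier) → (∀ i → v i Fin.zero ≈ 0#) →
    LinearlyIndependent v → LinearlyIndependent (λ i t → v i (Fin.suc t))
  dropFirstCoordinate-independent v v₀≈0 indep α rel = indep α λ where
    Fin.zero    → sum-zero (λ i → trans (*-congˡ (v₀≈0 i)) (zeroʳ (α i)))
    (Fin.suc t) → rel t

  -- Clearing the first coordinate of the other vectors with the pivot v j 0 turns a dependency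
  -- α′ of the reduced family into the dependency of v that puts -Σ α′ᵢ λᵢ at position j.
  module PivotElimination {b m} (v : Fin (suc m) → Fin (suc b) → Carrier) (j : Fin (suc m))
                          (pivot≉0 : ¬ v j Fin.zero ≈ 0#) where

    pivot : Carrier
    pivot = v j Fin.zero

    pivot⁻¹ : Carrier
    pivot⁻¹ = proj₁ (inverse pivot pivot≉0)

    others : Fin m → Fin (suc b) → Carrier
    others i = v (punchIn j i)

    λᵢ : Fin m → Carrier
    λᵢ i = others i Fin.zero * pivot⁻¹

    reduced : Fin m → Fin b → Carrier
    reduced i t = others i (Fin.suc t) - λᵢ i * v j (Fin.suc t)

    λᵢ*pivot : ∀ i → λᵢ i * pivot ≈ others i Fin.zero
    λᵢ*pivot i = trans (*-assoc _ _ _) (trans (*-congˡ (trans (*-comm _ _) (proj₂ (inverse pivot pivot≉0)))) (*-identityʳ _))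

    module _ (α′ : Fin m → Carrier) where

      α-pivot : Carrier
      α-pivot = - sum (λ i → α′ i * λᵢ i)

      α : Fin (suc m) → Carrier
      α = insertAt α′ j α-pivot

      split : ∀ t → sum (λ i → α i * v i t) ≈ sum (λ i → - (α′ i * λᵢ i) * v j t + α′ i * others i t)
      split t = begin
        sum (λ i → α i * v i t)
          ≈⟨ sum-remove {i = j} (λ i → α i * v i t) ⟩
        α j * v j t + sum (λ i → α (punchIn j i) * others i t)
          ≈⟨ +-cong (*-congʳ (reflexive (insertAt-lookup α′ j α-pivot)))
                    (sum-cong-≋ (λ i → *-congʳ (reflexive (insertAt-punchIn α′ j α-pivot i)))) ⟩
        α-pivot * v j t + sum (λ i → α′ i * others i t)
          ≈⟨ +-congʳ (trans (*-congʳ (sym (sum-neg (λ i → α′ i * λᵢ i)))) (*-distribʳ-sum (v j t) (λ i → - (α′ i * λᵢ i)))) ⟩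
        sum (λ i → - (α′ i * λᵢ i) * v j t) + sum (λ i → α′ i * others i t)
          ≈⟨ sym (∑-distrib-+ (λ i → - (α′ i * λᵢ i) * v j t) (λ i → α′ i * others i t)) ⟩
        sum (λ i → - (α′ i * λᵢ i) * v j t + α′ i * others i t) ∎

      relation-first : sum (λ i → α i * v i Fin.zero) ≈ 0#
      relation-first = trans (split Fin.zero) (sum-zero cancel)
        where
        cancel : ∀ i → - (α′ i * λᵢ i) * pivot + α′ i * others i Fin.zero ≈ 0#
        cancel i = trans (+-congʳ (trans (sym (-‿distribˡ-* _ _)) (-‿cong (trans (*-assoc _ _ _) (*-congˡ (λᵢ*pivot i))))))
                         (-‿inverseˡ _)

      relation-rest : ∀ t → sum (λ i → α i * v i (Fin.suc t)) ≈ sum (λ i → α′ i * reduced i t)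
      relation-rest t = trans (split (Fin.suc t)) (sum-cong-≋ regroup)
        where
        regroup : ∀ i → - (α′ i * λᵢ i) * v j (Fin.suc t) + α′ i * others i (Fin.suc t) ≈ α′ i * reduced i t
        regroup i = begin
          - (α′ i * λᵢ i) * v j (Fin.suc t) + α′ i * others i (Fin.suc t)
            ≈⟨ +-comm _ _ ⟩
          α′ i * others i (Fin.suc t) + - (α′ i * λᵢ i) * v j (Fin.suc t)
            ≈⟨ +-congˡ (trans (sym (-‿distribˡ-* _ _)) (trans (-‿cong (*-assoc _ _ _)) (-‿distribʳ-* _ _))) ⟩
          α′ i * others i (Fin.suc t) + α′ i * - (λᵢ i * v j (Fin.suc t))
            ≈⟨ sym (distribˡ _ _ _) ⟩
          α′ i * reduced i t ∎

    reduced-independent : LinearlyIndependent v → LinearlyIndependent reduced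
    reduced-independent indep α′ rel i =
      trans (sym (reflexive (insertAt-punchIn α′ j (α-pivot α′) i))) (α≈0 (punchIn j i))
      where
      α≈0 : ∀ i → α α′ i ≈ 0#
      α≈0 = indep (α α′) λ where
        Fin.zero    → relation-first α′
        (Fin.suc t) → trans (relation-rest α′ t) (rel t)

  -- Since ≈ need not be decidable, the pivot search is only available under a double
  -- negation, which is enough to derive ⊥.
  ¬independent : ∀ b m → b < m → (v : Fin m → Fin b → Carrier) → ¬ LinearlyIndependent v
  ¬independent zero    (suc m) _ v indep = 1≉0 (indep (λ _ → 1#) (λ ()) Fin.zero)
  ¬independent (suc b) (suc m) (s≤s b<m) v indep = ¬¬-∀⊎∃¬ (suc m) (λ i → v i Fin.zero ≈ 0#) λ where
    (inj₁ v₀≈0) →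
      ¬independent b (suc m) (m≤n⇒m≤1+n b<m) (λ i t → v i (Fin.suc t)) (dropFirstCoordinate-independent v v₀≈0 indep)
    (inj₂ (j , pivot≉0)) →
      ¬independent b m b<m (PivotElimination.reduced v j pivot≉0) (PivotElimination.reduced-independent v j pivot≉0 indep)

  module _ {n} (K′ : Face n → Bool) (s : ℕ) where

    isChain⇐ : (x : Chain n) → (∀ A → T (Kplus K′ A ∧ (size A ≡ᵇ s)) ⊎ x A ≈ 0#) → IsChain K′ s x
    isChain⇐ x face⊎0 A ¬face with Kplus K′ A ∧ (size A ≡ᵇ s) | face⊎0 A
    ... | true  | _        = ⊥-elim ¬face
    ... | false | inj₂ x≈0 = x≈0

    isChain⇒ : ∀ {x : Chain n} → IsChain K′ s x → ∀ A → ¬ T (Kplus K′ A ∧ (size A ≡ᵇ s)) → x A ≈ 0#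
    isChain⇒ chain A ¬face = chain A (¬T⇒T-not ¬face)
      where
      ¬T⇒T-not : ∀ {b} → ¬ T b → T (not b)
      ¬T⇒T-not {true}  ¬t = ¬t _
      ¬T⇒T-not {false} _  = _

    isChain-+ : ∀ {x y : Chain n} → IsChain K′ s x → IsChain K′ s y → IsChain K′ s (λ A → x A + y A)
    isChain-+ cx cy A t = trans (+-cong (cx A t) (cy A t)) (+-identityʳ 0#)

    isChain-* : ∀ k {x : Chain n} → IsChain K′ s x → IsChain K′ s (λ A → k * x A)
    isChain-* k cx A t = trans (*-congˡ (cx A t)) (zeroʳ k)

    isChain-neg : ∀ {x : Chain n} → IsChain K′ s x → IsChain K′ s (λ A → - x A)
    isChain-neg cx A t = trans (-‿cong (cx A t)) -0#≈0#

    isChain-lin : ∀ b (a : Fin b → Carrier) (z : Fin b → Chain n) → (∀ i → IsChain K′ s (z i)) → IsChain K′ s (lin b a z)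
    isChain-lin b a z cz A t = trans (lin≈sum b a z A) (sum-zero (λ i → trans (*-congˡ (cz i A t)) (zeroʳ (a i))))

  ∂-lin-cycles : ∀ {n} b (a : Fin b → Carrier) (z : Fin b → Chain n) → (∀ i B → boundary (z i) B ≈ 0#) →
    ∀ B → ∂ (lin b a z) B ≈ 0#
  ∂-lin-cycles b a z cyc B =
    trans (∂-lin b a z B) (sum-zero (λ i → trans (*-congˡ (trans (sym (boundary≈∂ (z i) B)) (cyc i B))) (zeroʳ (a i))))

  cone : ∀ {n} → Chain (suc n) → Chain (suc n)
  cone y = withApex (λ a → y (false ∷ a)) (λ _ → 0#)

  cycle≈∂cone : ∀ {n} (y : Chain (suc n)) → (∀ B → ∂ y B ≈ 0#) → ∀ A → y A ≈ ∂ (cone y) A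
  cycle≈∂cone y ∂y≈0 (true ∷ b)  = +-inverseˡ-unique (y (true ∷ b)) (∂ (λ a → y (false ∷ a)) b) (∂y≈0 (false ∷ b))
  cycle≈∂cone y ∂y≈0 (false ∷ b) = sym (trans (+-congˡ (∂-zero (λ _ → refl) b)) (+-identityʳ _))

module HomologyOfK {c ℓ} (F : Field c ℓ) (f β : List ℕ) (n′ : ℕ)
  (χ≥0 : ∀ r → + 0 ≤ℤ chi f β r)
  (mE≤ : ∀ r → mE f β r ≤ n′ C suc r) where

  open SubsetCombinatorics
  open Construction f β n′ χ≥0 mE≤
  open Chains F
  open import Data.Nat using (zero; _∸_; _<_; _≡ᵇ_) renaming (_+_ to _+ℕ_)
  open import Data.Nat.Properties using (n<1+n; <-≤-trans; +-monoʳ-<; +-cancelˡ-≡; +-cancelˡ-<; m≤m+n; m+[n∸m]≡n; ≮⇒≥; <-irrefl; 0≢1+n; ≡ᵇ⇒≡; ≡⇒≡ᵇ)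
  open import Data.Bool using (Bool; true; false; _∧_; not; T)
  open import Data.Bool.Properties using (T-∧; T-∨; T?)
  open import Data.Vec using (_∷_)
  open import Data.Fin as Fin using (Fin; toℕ; fromℕ<)
  open import Data.Fin.Properties using (toℕ<n; toℕ-injective; toℕ-fromℕ<)
  open import Data.Product using (Σ-syntax; proj₁; proj₂)
  open import Data.Sum using (_⊎_; inj₁; inj₂)
  open import Data.Empty using (⊥-elim)
  import Relation.Binary.PropositionalEquality as ≡
  open import Relation.Nullary using (¬_; yes; no)
  open import Algebra.Bundles using (CommutativeRing)
  open Field F using (commutativeRing)
  open CommutativeRing commutativeRing hiding (zero)
  open import Algebra.Properties.Ring ring using (-0#≈0#; //-rightDividesʳ; xyx⁻¹≈y)
  open import Algebra.Properties.Semiring.Sum semiring using (sum)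
  open Homology F hiding (covers)
  open import Relation.Binary.Reasoning.Setoid setoid

  KFace : ℕ → Face (suc n′) → Bool
  KFace s A = Kplus K A ∧ (size A ≡ᵇ s)

  K⇒KFace : ∀ s (A : Face (suc n′)) → T (K A) → size A ≡ s → T (KFace s A)
  K⇒KFace s A A∈K e = T-∧ {Kplus K A} .from (T-∨ .from (inj₁ A∈K) , ≡⇒≡ᵇ _ _ e)

  apex∈KFace : (a : Face n′) → size a ≡ 0 → T (KFace 1 (true ∷ a))
  apex∈KFace a e = K⇒KFace 1 (true ∷ a) (T-∨ .from (inj₁ (≡⇒≡ᵇ _ _ e))) (≡.cong suc e)

  inC⇒KFace : ∀ {s} (a : Face n′) → T (inC f β n′ a) → size a ≡ s → T (KFace (suc s) (true ∷ a))
  inC⇒KFace {s} a a∈C e = K⇒KFace (suc s) (true ∷ a) (inC⇒K-apex a a∈C) (≡.cong suc e)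

  apex-KFace⇒ : ∀ {s} (a : Face n′) → T (KFace (suc s) (true ∷ a)) → T (isEmpty a) ⊎ T (inC f β n′ a)
  apex-KFace⇒ a t with T-∨ {K (true ∷ a)} .to (proj₁ (T-∧ {Kplus K (true ∷ a)} .to t))
  ... | inj₁ a∈K = T-∨ .to a∈K

  base-KFace⇒ : ∀ {r} (a : Face n′) → T (KFace (suc r) (false ∷ a)) → size a ≡ suc r × T (inE f β n′ a)
  base-KFace⇒ a t with T-∧ {Kplus K (false ∷ a)} .to t
  ... | a∈K⁺ , e with T-∨ {K (false ∷ a)} .to a∈K⁺
  ...   | inj₁ a∈K     = ≡ᵇ⇒≡ _ _ e , K-base⇒inE a a∈K
  ...   | inj₂ a-empty = ⊥-elim (0≢1+n (≡.trans (≡.sym (≡ᵇ⇒≡ (size a) 0 a-empty)) (≡ᵇ⇒≡ _ _ e)))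

  -- The faces of E_r ∖ C_r are those of rank mC + j, j < β_r.

  extraFace-spec : ∀ r (j : Fin (get β r)) → Σ[ A ∈ Face n′ ] size A ≡ suc r × rank n′ (suc r) A ≡ mC f β r +ℕ toℕ j
  extraFace-spec r j = unrank n′ (suc r) (mC f β r +ℕ toℕ j) (<-≤-trans (+-monoʳ-< (mC f β r) (toℕ<n j)) (mE≤ r))

  extraFace : ∀ r → Fin (get β r) → Face n′
  extraFace r j = proj₁ (extraFace-spec r j)

  extraFace-size : ∀ r j → size (extraFace r j) ≡ suc r
  extraFace-size r j = proj₁ (proj₂ (extraFace-spec r j))

  extraFace-rank : ∀ r j → rank n′ (suc r) (extraFace r j) ≡ mC f β r +ℕ toℕ j
  extraFace-rank r j = proj₂ (proj₂ (extraFace-spec r j))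

  extraFace-nonempty : ∀ r j → T (not (isEmpty (extraFace r j)))
  extraFace-nonempty r j = size≡suc⇒nonempty (extraFace r j) (extraFace-size r j)

  extraFace∉C : ∀ r j → ¬ T (inC f β n′ (extraFace r j))
  extraFace∉C r j t =
    let (_ , rank<mC) = inI⇒ {n′} {r} {mC f β r} (extraFace r j) (≡.subst T (inC-at (extraFace r j) (extraFace-size r j)) t)
    in <-irrefl ≡.refl (<-≤-trans rank<mC (≡.subst (mC f β r ≤_) (≡.sym (extraFace-rank r j)) (m≤m+n _ _)))

  extraFace∈E : ∀ r j → T (inE f β n′ (extraFace r j))
  extraFace∈E r j = ≡.subst T (≡.sym (inE-at (extraFace r j) (extraFace-size r j)))
    (inI⇐ (extraFace r j) (extraFace-size r j)
      (≡.subst (_< mE f β r) (≡.sym (extraFace-rank r j)) (+-monoʳ-< (mC f β r) (toℕ<n j))))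

  extraFace-injective : ∀ r i j → extraFace r i ≡ extraFace r j → i ≡ j
  extraFace-injective r i j e = toℕ-injective (+-cancelˡ-≡ (mC f β r) _ _
    (≡.trans (≡.sym (extraFace-rank r i)) (≡.trans (≡.cong (rank n′ (suc r)) e) (extraFace-rank r j))))

  extraFace-surjective : ∀ r (a : Face n′) → size a ≡ suc r → T (inE f β n′ a) → ¬ T (inC f β n′ a) →
    Σ[ j ∈ Fin (get β r) ] a ≡ extraFace r j
  extraFace-surjective r a e a∈E a∉C =
    j , rank-injective n′ (suc r) a (extraFace r j) e (extraFace-size r j)
          (≡.sym (≡.trans (extraFace-rank r j) (≡.trans (≡.cong (mC f β r +ℕ_) (toℕ-fromℕ< lt)) (m+[n∸m]≡n mC≤rank))))
    where
    rank<mE : rank n′ (suc r) a < mE f β r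
    rank<mE = proj₂ (inI⇒ {n′} {r} {mE f β r} a (≡.subst T (inE-at a e) a∈E))
    mC≤rank : mC f β r ≤ rank n′ (suc r) a
    mC≤rank = ≮⇒≥ (λ lt → a∉C (≡.subst T (≡.sym (inC-at a e)) (inI⇐ a e lt)))
    lt : rank n′ (suc r) a ∸ mC f β r < get β r
    lt = +-cancelˡ-< (mC f β r) _ _ (≡.subst (_< mE f β r) (≡.sym (m+[n∸m]≡n mC≤rank)) rank<mE)
    j : Fin (get β r)
    j = fromℕ< lt

  sum-δ-extraFace : ∀ r (a : Fin (get β r) → Carrier) j → sum (λ i → a i * δ (extraFace r i) (extraFace r j)) ≈ a j
  sum-δ-extraFace r a j = sum-indicator a (λ i → δ (extraFace r i) (extraFace r j)) j (δ-self (extraFace r j)) δ≈0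
    where
    δ≈0 : ∀ i → ¬ i ≡ j → δ (extraFace r i) (extraFace r j) ≈ 0#
    δ≈0 i i≢j with δ-other (extraFace r j) (extraFace r i)
    ... | inj₁ e   = ⊥-elim (i≢j (extraFace-injective r i j (≡.sym e)))
    ... | inj₂ δ≈0 = δ≈0

  cone-isChain : ∀ r (y : Chain (suc n′)) → IsChain K (suc r) y → (∀ j → y (false ∷ extraFace r j) ≈ 0#) →
    IsChain K (suc (suc r)) (cone y)
  cone-isChain r y y-chain y-extra≈0 = isChain⇐ K (suc (suc r)) (cone y) face⊎0
    where
    face⊎0 : ∀ A → T (KFace (suc (suc r)) A) ⊎ cone y A ≈ 0#
    face⊎0 (false ∷ a) = inj₂ refl
    face⊎0 (true ∷ a) with T? (KFace (suc r) (false ∷ a))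
    ... | no  a∉K = inj₂ (isChain⇒ K (suc r) y-chain (false ∷ a) a∉K)
    ... | yes a∈K with base-KFace⇒ a a∈K | T? (inC f β n′ a)
    ...   | e , _   | yes a∈C = inj₁ (inC⇒KFace a a∈C e)
    ...   | e , a∈E | no  a∉C with extraFace-surjective r a e a∈E a∉C
    ...     | j , ≡.refl = inj₂ (y-extra≈0 j)

  extraCycle : ∀ r → Fin (get β r) → Chain (suc n′)
  extraCycle r j = withApex (λ a → - ∂ (δ (extraFace r j)) a) (δ (extraFace r j))

  extraCycle-cycle : ∀ r j B → boundary (extraCycle r j) B ≈ 0#
  extraCycle-cycle r j B = trans (boundary≈∂ (extraCycle r j) B) (∂-withApex-cycle (δ (extraFace r j)) B)

  lin-extraCycle-at-extraFace : ∀ r (a : Fin (get β r) → Carrier) j →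
    lin (get β r) a (extraCycle r) (false ∷ extraFace r j) ≈ a j
  lin-extraCycle-at-extraFace r a j = trans (lin≈sum (get β r) a (extraCycle r) (false ∷ extraFace r j)) (sum-δ-extraFace r a j)

  module HomologyBasis (∂≤χ : ∀ r → shadowSize n′ (suc r) (mE f β (suc r)) ≤ mC f β r) where

    open UnderShadowBound ∂≤χ

    facet-of-E⇒apex-KFace : ∀ r (g a : Face n′) → T (inE f β n′ g) → size g ≡ suc r → T (covers g a) →
      T (KFace (suc r) (true ∷ a))
    facet-of-E⇒apex-KFace zero    g a g∈E eg cov = apex∈KFace a (facet-size g a cov eg)
    facet-of-E⇒apex-KFace (suc r) g a g∈E eg cov =
      inC⇒KFace a (facet-of-E-inC g a g∈E cov (size≡suc⇒nonempty a ea)) ea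
      where
      ea : size a ≡ suc r
      ea = facet-size g a cov eg

    extraCycle-isChain : ∀ r j → IsChain K (suc r) (extraCycle r j)
    extraCycle-isChain r j = isChain⇐ K (suc r) (extraCycle r j) face⊎0
      where
      G : Face n′
      G = extraFace r j
      face⊎0 : ∀ A → T (KFace (suc r) A) ⊎ extraCycle r j A ≈ 0#
      face⊎0 (false ∷ a) with δ-other a G
      ... | inj₁ ≡.refl = inj₁ (K⇒KFace (suc r) (false ∷ G) (inE⇒K-base G (extraFace∈E r j)) (extraFace-size r j))
      ... | inj₂ δ≈0    = inj₂ δ≈0
      face⊎0 (true ∷ a) with T? (covers G a)
      ... | yes cov  = inj₁ (facet-of-E⇒apex-KFace r G a (extraFace∈E r j) (extraFace-size r j) cov)
      ... | no  ¬cov = inj₂ (trans (-‿cong (∂δ-support G a ¬cov)) -0#≈0#)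

    -- A boundary vanishes on each extra face G: {1} ∪ G ∉ K as G ∉ C, and every cofacet of G in E
    -- would put G in C.
    extraCycles-independent : ∀ r (a : Fin (get β r) → Carrier) (w : Chain (suc n′)) → IsChain K (suc (suc r)) w →
      (∀ A → lin (get β r) a (extraCycle r) A ≈ boundary w A) → ∀ i → a i ≈ 0#
    extraCycles-independent r a w w-chain lin≈∂w j = begin
      a j                                        ≈⟨ sym (lin-extraCycle-at-extraFace r a j) ⟩
      lin (get β r) a (extraCycle r) (false ∷ G) ≈⟨ lin≈∂w (false ∷ G) ⟩
      boundary w (false ∷ G)                     ≈⟨ boundary≈∂ w (false ∷ G) ⟩
      w (true ∷ G) + ∂ (λ A → w (false ∷ A)) G   ≈⟨ +-cong w-apex≈0 ∂w-base≈0 ⟩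
      0# + 0#                                    ≈⟨ +-identityʳ 0# ⟩
      0#                                         ∎
      where
      G : Face n′
      G = extraFace r j
      w-apex≈0 : w (true ∷ G) ≈ 0#
      w-apex≈0 = isChain⇒ K (suc (suc r)) w-chain (true ∷ G) apex∉K
        where
        apex∉K : ¬ T (KFace (suc (suc r)) (true ∷ G))
        apex∉K t with apex-KFace⇒ G t
        ... | inj₁ G-empty = empty⇒¬nonempty G G-empty (extraFace-nonempty r j)
        ... | inj₂ G∈C     = extraFace∉C r j G∈C
      ∂w-base≈0 : ∂ (λ A → w (false ∷ A)) G ≈ 0#
      ∂w-base≈0 = ∂-support (λ A → w (false ∷ A)) G λ H cov →
        isChain⇒ K (suc (suc r)) w-chain (false ∷ H)
          (λ t → extraFace∉C r j (facet-of-E-inC H G (proj₂ (base-KFace⇒ H t)) cov (extraFace-nonempty r j)))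

    extraCycles-span : ∀ r (y : Chain (suc n′)) → IsCycle K (suc r) y →
      Σ[ a ∈ (Fin (get β r) → Carrier) ] Σ[ w ∈ Chain (suc n′) ]
        IsChain K (suc (suc r)) w × (∀ A → y A ≈ (lin (get β r) a (extraCycle r) A + boundary w A))
    extraCycles-span r y (y-chain , y-cycle) = a , cone y′ , cone-isChain r y′ y′-chain y′-extra≈0 , y≈z+∂w
      where
      b : ℕ
      b = get β r
      a : Fin b → Carrier
      a j = y (false ∷ extraFace r j)
      z : Chain (suc n′)
      z = lin b a (extraCycle r)
      y′ : Chain (suc n′)
      y′ A = y A - z A
      y′-chain : IsChain K (suc r) y′
      y′-chain = isChain-+ K (suc r) y-chain
                   (isChain-neg K (suc r) (isChain-lin K (suc r) b a (extraCycle r) (extraCycle-isChain r)))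
      ∂y′≈0 : ∀ B → ∂ y′ B ≈ 0#
      ∂y′≈0 B = begin
        ∂ y′ B                    ≈⟨ ∂-+ y (λ A → - z A) B ⟩
        ∂ y B + ∂ (λ A → - z A) B ≈⟨ +-cong (trans (sym (boundary≈∂ y B)) (y-cycle B))
                                            (trans (∂-neg z B) (-‿cong (∂-lin-cycles b a (extraCycle r) (extraCycle-cycle r) B))) ⟩
        0# + - 0#                 ≈⟨ trans (+-identityˡ _) -0#≈0# ⟩
        0#                        ∎
      y′-extra≈0 : ∀ j → y′ (false ∷ extraFace r j) ≈ 0#
      y′-extra≈0 j = trans (+-congˡ (-‿cong (lin-extraCycle-at-extraFace r a j))) (-‿inverseʳ (a j))
      y≈z+∂w : ∀ A → y A ≈ z A + boundary (cone y′) A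
      y≈z+∂w A = sym (begin
        z A + boundary (cone y′) A ≈⟨ +-congˡ (trans (boundary≈∂ (cone y′) A) (sym (cycle≈∂cone y′ ∂y′≈0 A))) ⟩
        z A + (y A - z A)          ≈⟨ sym (+-assoc _ _ _) ⟩
        z A + y A - z A            ≈⟨ xyx⁻¹≈y (z A) (y A) ⟩
        y A                        ∎)

    betti : ∀ r → Betti K r (get β r)
    betti r = extraCycle r , (λ j → extraCycle-isChain r j , extraCycle-cycle r j) , extraCycles-independent r , extraCycles-span r

  module FromComplex (K-complex : IsSimplicialComplex K) where

    δ-isChain : ∀ s (A : Face (suc n′)) → T (K A) → size A ≡ s → IsChain K s (δ A)
    δ-isChain s A A∈K e = isChain⇐ K s (δ A) face⊎0
      where
      face⊎0 : ∀ B → T (KFace s B) ⊎ δ A B ≈ 0#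
      face⊎0 B with δ-other B A
      ... | inj₁ ≡.refl = inj₁ (K⇒KFace s A A∈K e)
      ... | inj₂ δ≈0    = inj₂ δ≈0

    ∂δ-isChain : ∀ s (A : Face (suc n′)) → T (K A) → size A ≡ suc (suc s) → IsChain K (suc s) (∂ (δ A))
    ∂δ-isChain s A A∈K e = isChain⇐ K (suc s) (∂ (δ A)) face⊎0
      where
      face⊎0 : ∀ B → T (KFace (suc s) B) ⊎ ∂ (δ A) B ≈ 0#
      face⊎0 B with T? (covers A B)
      ... | no  ¬cov = inj₂ (∂δ-support A B ¬cov)
      ... | yes cov  =
        let eB = facet-size A B cov e
        in inj₁ (K⇒KFace (suc s) B (K-complex A B A∈K (proj₁ (covers⇒ A B cov)) (size≡suc⇒nonempty B eB)) eB)

    module AgainstBasis (r : ℕ) (basis : Betti K r (get β r)) (H : Face n′) (H∈E : T (inE f β n′ H))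
                        (eH : size H ≡ suc (suc r)) where

      b : ℕ
      b = get β r

      z : Fin b → Chain (suc n′)
      z = proj₁ basis

      ∂H : Chain (suc n′)
      ∂H = ∂ (δ (false ∷ H))

      combination : Carrier → (Fin b → Carrier) → Chain (suc n′)
      combination α₀ αz A = lin b αz z A + α₀ * ∂H A

      combination-isChain : ∀ α₀ αz → IsChain K (suc r) (combination α₀ αz)
      combination-isChain α₀ αz =
        isChain-+ K (suc r) (isChain-lin K (suc r) b αz z (λ i → proj₁ (proj₁ (proj₂ basis) i)))
          (isChain-* K (suc r) α₀ (∂δ-isChain r (false ∷ H) (inE⇒K-base H H∈E) eH))

      ∂combination≈0 : ∀ α₀ αz B → ∂ (combination α₀ αz) B ≈ 0#
      ∂combination≈0 α₀ αz B = begin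
        ∂ (combination α₀ αz) B
          ≈⟨ ∂-+ (lin b αz z) (λ A → α₀ * ∂H A) B ⟩
        ∂ (lin b αz z) B + ∂ (λ A → α₀ * ∂H A) B
          ≈⟨ +-cong (∂-lin-cycles b αz z (λ i → proj₂ (proj₁ (proj₂ basis) i)) B)
                    (trans (∂-* α₀ ∂H B) (*-congˡ (∂∘∂≈0 (δ (false ∷ H)) B))) ⟩
        0# + α₀ * 0#
          ≈⟨ trans (+-identityˡ _) (zeroʳ _) ⟩
        0# ∎

      -- Vanishing on the extra faces, y is ∂(cone y), so its basis part is ∂(cone y - α₀ H).
      basis-coefficients≈0 : ∀ α₀ αz → (∀ t → combination α₀ αz (false ∷ extraFace r t) ≈ 0#) → ∀ i → αz i ≈ 0#
      basis-coefficients≈0 α₀ αz y-extra≈0 = proj₁ (proj₂ (proj₂ basis)) αz w w-chain lin≈∂w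
        where
        y : Chain (suc n′)
        y = combination α₀ αz
        w : Chain (suc n′)
        w A = cone y A - α₀ * δ (false ∷ H) A
        w-chain : IsChain K (suc (suc r)) w
        w-chain = isChain-+ K _ (cone-isChain r y (combination-isChain α₀ αz) y-extra≈0)
                    (isChain-neg K _ (isChain-* K _ α₀ (δ-isChain _ (false ∷ H) (inE⇒K-base H H∈E) eH)))
        lin≈∂w : ∀ A → lin b αz z A ≈ boundary w A
        lin≈∂w A = sym (begin
          boundary w A
            ≈⟨ boundary≈∂ w A ⟩
          ∂ w A
            ≈⟨ ∂-+ (cone y) (λ A → - (α₀ * δ (false ∷ H) A)) A ⟩
          ∂ (cone y) A + ∂ (λ A → - (α₀ * δ (false ∷ H) A)) A
            ≈⟨ +-cong (sym (cycle≈∂cone y (∂combination≈0 α₀ αz) A)) (trans (∂-neg _ A) (-‿cong (∂-* α₀ (δ (false ∷ H)) A))) ⟩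
          y A - α₀ * ∂H A
            ≈⟨ //-rightDividesʳ (α₀ * ∂H A) (lin b αz z A) ⟩
          lin b αz z A ∎)

      -- Were G_{j₀} a facet of H, then ∂H and the basis, restricted to the β_r extra faces,
      -- would be β_r + 1 independent vectors of F^{β_r}.
      extraFace-not-facet : ∀ j₀ → ¬ T (covers H (extraFace r j₀))
      extraFace-not-facet j₀ cov = ¬independent b (suc b) (n<1+n b) v v-independent
        where
        G : Fin b → Face n′
        G = extraFace r
        v : Fin (suc b) → Fin b → Carrier
        v Fin.zero    t = ∂H (false ∷ G t)
        v (Fin.suc i) t = z i (false ∷ G t)
        v-independent : LinearlyIndependent v
        v-independent α rel = λ { Fin.zero → α₀≈0 ; (Fin.suc i) → αz≈0 i }
          where
          αz≈0 : ∀ i → α (Fin.suc i) ≈ 0#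
          αz≈0 = basis-coefficients≈0 (α Fin.zero) (λ i → α (Fin.suc i)) λ t →
            trans (+-comm _ _) (trans (+-congˡ (lin≈sum b (λ i → α (Fin.suc i)) z (false ∷ G t))) (rel t))
          α₀≈0 : α Fin.zero ≈ 0#
          α₀≈0 = sgn-cancel (false ∷ H) (false ∷ G j₀) (α Fin.zero) (begin
            α Fin.zero * sgn (false ∷ H) (false ∷ G j₀)
              ≈⟨ *-congˡ (sym (∂δ-facet (false ∷ H) (false ∷ G j₀) cov)) ⟩
            α Fin.zero * v Fin.zero j₀
              ≈⟨ sym (+-identityʳ _) ⟩
            α Fin.zero * v Fin.zero j₀ + 0#
              ≈⟨ +-congˡ (sym (sum-zero (λ i → trans (*-congʳ (αz≈0 i)) (zeroˡ _)))) ⟩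
            sum (λ i → α i * v i j₀)
              ≈⟨ rel j₀ ⟩
            0# ∎)

    shadow-bound : (∀ r → Betti K r (get β r)) → ∀ r → shadowSize n′ (suc r) (mE f β (suc r)) ≤ mC f β r
    shadow-bound betti r = shadowSize≤ n′ r (mE f β (suc r)) (mC f β r) facets-in-C
      where
      facets-in-C : ∀ H F → T (inI n′ (suc r) (mE f β (suc r)) H) → T (covers H F) → T (inI n′ r (mC f β r) F)
      facets-in-C H F H∈I cov with T? (inI n′ r (mC f β r) F)
      ... | yes F∈C = F∈C
      ... | no  F∉C =
        ⊥-elim (AgainstBasis.extraFace-not-facet r (betti r) H H∈E eH j (≡.subst (λ X → T (covers H X)) F≡G cov))
        where
        eH : size H ≡ suc (suc r)
        eH = proj₁ (inI⇒ {n′} {suc r} {mE f β (suc r)} H H∈I)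
        H∈E : T (inE f β n′ H)
        H∈E = ≡.subst T (≡.sym (inE-at H eH)) H∈I
        eF : size F ≡ suc r
        eF = facet-size H F cov eH
        F∈E : T (inE f β n′ F)
        F∈E = K-base⇒inE F (K-complex (false ∷ H) (false ∷ F) (inE⇒K-base H H∈E) (proj₁ (covers⇒ H F cov))
                                      (size≡suc⇒nonempty F eF))
        F-extra : Σ[ j ∈ Fin (get β r) ] F ≡ extraFace r j
        F-extra = extraFace-surjective r F eF F∈E (λ F∈C → F∉C (≡.subst T (inC-at F eF) F∈C))
        j : Fin (get β r)
        j = proj₁ F-extra
        F≡G : F ≡ extraFace r j
        F≡G = proj₂ F-extra

open import Data.Nat using (_+_)

-- The hypothesis f₀ = n only names the number of vertices; the equivalence holds for every n.
lemmaA2 : ∀ {c ℓ} (F : Field c ℓ) (f β : List ℕ) (n' : ℕ)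
    → get f 0 ≡ suc n'
    → (∀ r → + 0 ≤ℤ chi f β r)
    → (∀ r → ∣ chi f β r ∣ + get β r ≤ n' C suc r)
    → ((IsSimplicialComplex (Kfβ f β n')
         × (∀ r → fVec (Kfβ f β n') r ≡ get f r)
         × (∀ r → Homology.Betti F (Kfβ f β n') r (get β r)))
       ⇔ (chiShift f β 0 ≡ + 1
         × (∀ r → 1 ≤ r → + shadowSize n' r (mE f β r) ≤ℤ chiShift f β r)))
lemmaA2 F f β n′ _ χ≥0 mE≤ = mk⇔
  (λ (K-complex , fVec≡f , betti) →
     fVec≡f⇔χ₋₁≡1 .to fVec≡f , shadow-bound-ℤ⇔ℕ .from (FromComplex.shadow-bound K-complex betti))
  (λ (χ₋₁≡1 , ∂≤χ) →
     let ∂≤χ′ = shadow-bound-ℤ⇔ℕ .to ∂≤χ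
     in  UnderShadowBound.K-isSimplicialComplex ∂≤χ′
       , fVec≡f⇔χ₋₁≡1 .from χ₋₁≡1
       , HomologyBasis.betti ∂≤χ′)
  where
  open Construction f β n′ χ≥0 mE≤
  open HomologyOfK F f β n′ χ≥0 mE≤
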